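{- There is a constant $C\in\mathbb{R}$ such that for every positive integer $n$, \[ 2n^{1/3}-2\;\le\;\#\,\mathrm{vert}\big(\mathrm{conv}(H_n\cap\mathbb{Z}^2)\big)\;\le\; C\,n^{1/3}(\log_2 n+2), \] where $H_n:=\{(x,y)\in\mathbb{R}_{\ge 0}^2: xy\ge n\}$.
   Context: $\mathrm{conv}$ denotes convex hull, $\mathrm{vert}(P)$ the set of vertices of a polyhedron $P$, and $\#$ cardinality. -}

module Defs where

open import Data.Nat as ℕ using (ℕ; _≤_)
open import Data.Integer using (+_)
open import Data.Rational as ℚ using (ℚ; 0ℚ; 1ℚ; _/_)
open import Data.Product using (_×_; _,_; proj₁; proj₂)
open import Data.List using (List; []; _∷_; map; foldr)
open import Data.List.Relation.Unary.All using (All)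
open import Relation.Binary.PropositionalEquality using (_≡_)
open import Relation.Nullary using (¬_)

Point : Set
Point = ℕ × ℕ

InH : ℕ → Point → Set
InH n (x , y) = n ≤ x ℕ.* y

toℚ : ℕ → ℚ
toℚ k = + k / 1

sumℚ : List ℚ → ℚ
sumℚ = foldr ℚ._+_ 0ℚ

IsConvexCombination : List (ℚ × Point) → Point → Set
IsConvexCombination ws (px , py) =
  All (λ w → 0ℚ ℚ.≤ proj₁ w) ws
  × sumℚ (map proj₁ ws) ≡ 1ℚ
  × sumℚ (map (λ w → proj₁ w ℚ.* toℚ (proj₁ (proj₂ w))) ws) ≡ toℚ px
  × sumℚ (map (λ w → proj₁ w ℚ.* toℚ (proj₂ (proj₂ w))) ws) ≡ toℚ py

-- p is a vertex (extreme point) of conv(H_n ∩ ℤ²):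
-- p ∈ H_n ∩ ℤ² and p ∉ conv((H_n ∩ ℤ²) ∖ {p})
IsVertex : ℕ → Point → Set
IsVertex n p =
  InH n p ×
  (∀ (ws : List (ℚ × Point)) →
     All (λ w → InH n (proj₂ w) × ¬ (proj₂ w ≡ p)) ws →
     ¬ IsConvexCombination ws p)

module Submission where

-- Only the lowest lattice point (x , ⌈n/x⌉) of a column 1 ≤ x ≤ n can be a vertex, and it is one exactly
-- when the boundary x ↦ ⌈n/x⌉ is strictly convex at x.  If it is not, the point is a combination with
-- natural weights of two boundary points and the point just above it; if it is, the flattest chord from the
-- left and the steepest chord to the right have separated slopes, and the linear functional whose slope is
-- their mean is minimised on H_n ∩ ℤ² at that point alone.  This makes the vertex set a decidable list.
--
-- Lower bound: for x³ < n the functional (n + x(x+1)) X + x(x+1) Y is minimised at (x , ⌈n/x⌉) alone, so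
-- these points and their mirror images are 2(⌈∛n⌉ − 1) vertices.
--
-- Upper bound: put c = ⌈∛n⌉ and group the vertices x < n into dyadic blocks 2^k ≤ x < 2^(k+1); let (a , b)
-- be the edge from x to the next vertex and s = 2^k / c, t = ⌈n/2^k⌉ / c, so that s t < 2c.  In a block,
-- edges with a ≤ s and b ≤ t are pairwise distinct (two equal edges would put a vertex below a chord), so
-- there are fewer than 2c of them; vertices with a > s are more than s apart in a block shorter than
-- c (s + 1); vertices with b > t have heights dropping by more than t from at most ⌈n/2^k⌉ < c (t + 1).
-- This encodes the vertices injectively below 4 · 2c · (⌊log₂ n⌋ + 1).

open import Defs
open import Data.Nat using (ℕ; suc; _+_; _*_; _^_; _≤_)
open import Data.Nat.Logarithm using (⌊log₂_⌋)
open import Data.Product using (Σ; _×_)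
open import Data.List using (List; length)
open import Data.List.Relation.Unary.Unique.Propositional using (Unique)
open import Data.List.Membership.Propositional using (_∈_)
open import Function.Bundles using (_⇔_)

open import Data.Nat using (zero; _∸_; _<_; z≤n; s≤s; _≟_; _≤?_; _<?_; NonZero; >-nonZero)
open import Data.Nat.Properties hiding (_≟_; _≤?_; _<?_)
open import Data.Nat.DivMod using (_/_; _%_; m≡m%n+[m/n]*n; m%n<n; m/n≡1+[m∸n]/n; /-monoˡ-≤; m/n*n≤m; m<n*o⇒m/o<n)
open import Data.Nat.Logarithm using (⌊log₂⌋-mono-≤; ⌊log₂[2^n]⌋≡n)
open import Data.Nat.Tactic.RingSolver using (solve-∀)
import Data.Nat.Coprimality as Coprime
import Data.Integer as ℤ
import Data.Integer.Properties as ℤ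
open import Data.Rational as ℚ using (ℚ; mkℚ; 0ℚ; 1ℚ)
import Data.Rational.Properties as ℚ
open import Data.Rational.Solver using (module +-*-Solver)
open import Data.Product using (∃; _,_; proj₁; proj₂; map₁; map₂; swap)
open import Data.Sum using (inj₁; inj₂; [_,_])
open import Data.Empty using (⊥)
open import Data.List using ([]; _∷_; map; filter; upTo; _++_)
import Data.List.Properties as List
open import Data.List.Relation.Unary.All as All using (All; []; _∷_)
import Data.List.Relation.Unary.All.Properties as Allₚ
open import Data.List.Relation.Unary.Any as Any using (here; there)
open import Data.List.Relation.Unary.Unique.Propositional using ([]; _∷_)
import Data.List.Relation.Unary.Unique.Propositional.Properties as Unique
open import Data.List.Membership.Propositional using (_─_)
import Data.List.Membership.Propositional.Properties as ∈
open import Data.List.Relation.Binary.Subset.Propositional using (_⊆_)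
open import Function using (_∘_; const)
open import Function.Bundles using (mk⇔; Equivalence)
open import Relation.Binary.Definitions using (tri<; tri≈; tri>)
open import Relation.Binary.PropositionalEquality
  using (_≡_; _≢_; refl; sym; trans; cong; cong₂; subst; subst₂; module ≡-Reasoning)
open import Relation.Nullary using (¬_; Dec; yes; no; contradiction; _→-dec_; _×-dec_)
open import Relation.Nullary.Decidable using (decidable-stable)

-- Convex combinations

private
  toℚ≡mkℚ : ∀ k → toℚ k ≡ mkℚ (ℤ.+ k) 0 (Coprime.sym (Coprime.1-coprimeTo k))
  toℚ≡mkℚ k = ℚ.↥p/↧p≡p _

toℚ-+ : ∀ a b → toℚ (a + b) ≡ toℚ a ℚ.+ toℚ b
toℚ-+ a b rewrite toℚ≡mkℚ a | toℚ≡mkℚ b =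
  cong (ℚ._/ 1) (sym (cong₂ ℤ._+_ (ℤ.*-identityʳ (ℤ.+ a)) (ℤ.*-identityʳ (ℤ.+ b))))

toℚ-* : ∀ a b → toℚ (a * b) ≡ toℚ a ℚ.* toℚ b
toℚ-* a b rewrite toℚ≡mkℚ a | toℚ≡mkℚ b = cong (ℚ._/ 1) (ℤ.pos-* a b)

toℚ-mono-≤ : ∀ {a b} → a ≤ b → toℚ a ℚ.≤ toℚ b
toℚ-mono-≤ {a} {b} a≤b rewrite toℚ≡mkℚ a | toℚ≡mkℚ b =
  ℚ.*≤* (subst₂ ℤ._≤_ (sym (ℤ.*-identityʳ (ℤ.+ a))) (sym (ℤ.*-identityʳ (ℤ.+ b))) (ℤ.+≤+ a≤b))

toℚ-cancel-≤ : ∀ {a b} → toℚ a ℚ.≤ toℚ b → a ≤ b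
toℚ-cancel-≤ {a} {b} le rewrite toℚ≡mkℚ a | toℚ≡mkℚ b
  with subst₂ ℤ._≤_ (ℤ.*-identityʳ (ℤ.+ a)) (ℤ.*-identityʳ (ℤ.+ b)) (ℚ.drop-*≤* le)
... | ℤ.+≤+ a≤b = a≤b

wsum : (Point → ℚ) → List (ℚ × Point) → ℚ
wsum f ws = sumℚ (map (λ w → proj₁ w ℚ.* f (proj₂ w)) ws)

linear : ℕ → ℕ → Point → ℕ
linear α β (x , y) = α * x + β * y

totalWeight≡wsum-1 : ∀ ws → sumℚ (map proj₁ ws) ≡ wsum (const 1ℚ) ws
totalWeight≡wsum-1 ws = cong sumℚ (List.map-cong (λ w → sym (ℚ.*-identityʳ (proj₁ w))) ws)

toℚ-linear : ∀ α β x y → toℚ (linear α β (x , y)) ≡ toℚ α ℚ.* toℚ x ℚ.+ toℚ β ℚ.* toℚ y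
toℚ-linear α β x y = trans (toℚ-+ (α * x) (β * y)) (cong₂ ℚ._+_ (toℚ-* α x) (toℚ-* β y))

wsum-linear : ∀ α β ws →
  wsum (toℚ ∘ linear α β) ws ≡ toℚ α ℚ.* wsum (toℚ ∘ proj₁) ws ℚ.+ toℚ β ℚ.* wsum (toℚ ∘ proj₂) ws
wsum-linear α β [] = solve 2 (λ a b → con 0ℚ := a :* con 0ℚ :+ b :* con 0ℚ) refl (toℚ α) (toℚ β)
  where open +-*-Solver
wsum-linear α β ((w , (x , y)) ∷ ws) = begin
  w ℚ.* toℚ (linear α β (x , y)) ℚ.+ wsum (toℚ ∘ linear α β) ws
    ≡⟨ cong₂ (λ u v → w ℚ.* u ℚ.+ v) (toℚ-linear α β x y) (wsum-linear α β ws) ⟩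
  w ℚ.* (a ℚ.* toℚ x ℚ.+ b ℚ.* toℚ y) ℚ.+ (a ℚ.* wsum (toℚ ∘ proj₁) ws ℚ.+ b ℚ.* wsum (toℚ ∘ proj₂) ws)
    ≡⟨ rearrange w a b (toℚ x) (toℚ y) (wsum (toℚ ∘ proj₁) ws) (wsum (toℚ ∘ proj₂) ws) ⟩
  a ℚ.* (w ℚ.* toℚ x ℚ.+ wsum (toℚ ∘ proj₁) ws) ℚ.+ b ℚ.* (w ℚ.* toℚ y ℚ.+ wsum (toℚ ∘ proj₂) ws) ∎
  where
  open ≡-Reasoning
  a b : ℚ
  a = toℚ α
  b = toℚ β
  rearrange : ∀ w a b x y s t → w ℚ.* (a ℚ.* x ℚ.+ b ℚ.* y) ℚ.+ (a ℚ.* s ℚ.+ b ℚ.* t)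
                              ≡ a ℚ.* (w ℚ.* x ℚ.+ s) ℚ.+ b ℚ.* (w ℚ.* y ℚ.+ t)
  rearrange = solve 7 (λ w a b x y s t → w :* (a :* x :+ b :* y) :+ (a :* s :+ b :* t)
                                       := a :* (w :* x :+ s) :+ b :* (w :* y :+ t)) refl
    where open +-*-Solver

wsum-lowerBound : ∀ c f ws → All (λ w → 0ℚ ℚ.≤ proj₁ w) ws → All (λ w → c ℚ.≤ f (proj₂ w)) ws →
  c ℚ.* wsum (const 1ℚ) ws ℚ.≤ wsum f ws
wsum-lowerBound c f [] [] [] = ℚ.≤-reflexive (ℚ.*-zeroʳ c)
wsum-lowerBound c f ((w , p) ∷ ws) (0≤w ∷ nonneg) (c≤fp ∷ bounds) = begin
  c ℚ.* (w ℚ.* 1ℚ ℚ.+ wsum (const 1ℚ) ws)  ≡⟨ cong (λ u → c ℚ.* (u ℚ.+ _)) (ℚ.*-identityʳ w) ⟩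
  c ℚ.* (w ℚ.+ wsum (const 1ℚ) ws)         ≡⟨ ℚ.*-distribˡ-+ c w _ ⟩
  c ℚ.* w ℚ.+ c ℚ.* wsum (const 1ℚ) ws     ≤⟨ ℚ.+-mono-≤ head (wsum-lowerBound c f ws nonneg bounds) ⟩
  w ℚ.* f p ℚ.+ wsum f ws                  ∎
  where
  open ℚ.≤-Reasoning
  instance
    w-nonNeg : ℚ.NonNegative w
    w-nonNeg = ℚ.nonNegative 0≤w
  head : c ℚ.* w ℚ.≤ w ℚ.* f p
  head = subst (ℚ._≤ w ℚ.* f p) (ℚ.*-comm w c) (ℚ.*-monoˡ-≤-nonNeg w c≤fp)

strictMinimum⇒IsVertex : ∀ {n} α β (p : Point) → InH n p →
  (∀ q → InH n q → q ≢ p → linear α β p < linear α β q) → IsVertex n p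
strictMinimum⇒IsVertex α β p@(x , y) p∈H minimal = p∈H , λ ws others (nonneg , total≡1 , x≡ , y≡) →
  n≮n (linear α β p) (toℚ-cancel-≤ (begin
    toℚ (suc (linear α β p))                      ≡⟨ sym (ℚ.*-identityʳ _) ⟩
    toℚ (suc (linear α β p)) ℚ.* 1ℚ
      ≡⟨ cong (toℚ (suc (linear α β p)) ℚ.*_) (trans (sym total≡1) (totalWeight≡wsum-1 ws)) ⟩
    toℚ (suc (linear α β p)) ℚ.* wsum (const 1ℚ) ws
      ≤⟨ wsum-lowerBound _ _ ws nonneg (All.map (λ (q∈H , q≢p) → toℚ-mono-≤ (minimal _ q∈H q≢p)) others) ⟩
    wsum (toℚ ∘ linear α β) ws                    ≡⟨ wsum-linear α β ws ⟩
    toℚ α ℚ.* wsum (toℚ ∘ proj₁) ws ℚ.+ toℚ β ℚ.* wsum (toℚ ∘ proj₂) ws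
      ≡⟨ cong₂ (λ u v → toℚ α ℚ.* u ℚ.+ toℚ β ℚ.* v) x≡ y≡ ⟩
    toℚ α ℚ.* toℚ x ℚ.+ toℚ β ℚ.* toℚ y          ≡⟨ sym (toℚ-linear α β x y) ⟩
    toℚ (linear α β p)                            ∎))
  where open ℚ.≤-Reasoning

natSum : (Point → ℕ) → List (ℕ × Point) → ℕ
natSum f [] = 0
natSum f ((c , p) ∷ cs) = c * f p + natSum f cs

scaleWeights : ℚ → List (ℕ × Point) → List (ℚ × Point)
scaleWeights r = map (map₁ (λ c → toℚ c ℚ.* r))

wsum-scaleWeights : ∀ f r cs → wsum (toℚ ∘ f) (scaleWeights r cs) ≡ toℚ (natSum f cs) ℚ.* r
wsum-scaleWeights f r [] = sym (ℚ.*-zeroˡ r)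
wsum-scaleWeights f r ((c , p) ∷ cs) = begin
  (toℚ c ℚ.* r) ℚ.* toℚ (f p) ℚ.+ wsum (toℚ ∘ f) (scaleWeights r cs)
    ≡⟨ cong ((toℚ c ℚ.* r) ℚ.* toℚ (f p) ℚ.+_) (wsum-scaleWeights f r cs) ⟩
  (toℚ c ℚ.* r) ℚ.* toℚ (f p) ℚ.+ toℚ (natSum f cs) ℚ.* r
    ≡⟨ rearrange (toℚ c) r (toℚ (f p)) (toℚ (natSum f cs)) ⟩
  (toℚ c ℚ.* toℚ (f p) ℚ.+ toℚ (natSum f cs)) ℚ.* r
    ≡⟨ cong (ℚ._* r) (sym (trans (toℚ-+ (c * f p) _) (cong (ℚ._+ _) (toℚ-* c (f p))))) ⟩
  toℚ (c * f p + natSum f cs) ℚ.* r ∎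
  where
  open ≡-Reasoning
  rearrange : ∀ c r x s → (c ℚ.* r) ℚ.* x ℚ.+ s ℚ.* r ≡ (c ℚ.* x ℚ.+ s) ℚ.* r
  rearrange = solve 4 (λ c r x s → (c :* r) :* x :+ s :* r := (c :* x :+ s) :* r) refl
    where open +-*-Solver

private
  1/suc : ℕ → ℚ
  1/suc k = mkℚ (ℤ.+ 1) k (Coprime.1-coprimeTo (suc k))

  suc*1/suc : ∀ k a → toℚ (suc k * a) ℚ.* 1/suc k ≡ toℚ a
  suc*1/suc k a = begin
    toℚ (suc k * a) ℚ.* 1/suc k           ≡⟨ cong (ℚ._* 1/suc k) (toℚ-* (suc k) a) ⟩
    (toℚ (suc k) ℚ.* toℚ a) ℚ.* 1/suc k   ≡⟨ ℚ.*-assoc (toℚ (suc k)) (toℚ a) (1/suc k) ⟩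
    toℚ (suc k) ℚ.* (toℚ a ℚ.* 1/suc k)   ≡⟨ cong (toℚ (suc k) ℚ.*_) (ℚ.*-comm (toℚ a) (1/suc k)) ⟩
    toℚ (suc k) ℚ.* (1/suc k ℚ.* toℚ a)   ≡⟨ ℚ.*-assoc (toℚ (suc k)) (1/suc k) (toℚ a) ⟨
    (toℚ (suc k) ℚ.* 1/suc k) ℚ.* toℚ a   ≡⟨ cong (ℚ._* toℚ a) inverse ⟩
    1ℚ ℚ.* toℚ a                          ≡⟨ ℚ.*-identityˡ (toℚ a) ⟩
    toℚ a                                 ∎
    where
    open ≡-Reasoning
    inverse : toℚ (suc k) ℚ.* 1/suc k ≡ 1ℚ
    inverse rewrite toℚ≡mkℚ (suc k) = ℚ.*-inverseʳ (mkℚ (ℤ.+ suc k) 0 (Coprime.sym (Coprime.1-coprimeTo (suc k))))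

  scaleWeights-nonNeg : ∀ k cs → All (λ w → 0ℚ ℚ.≤ proj₁ w) (scaleWeights (1/suc k) cs)
  scaleWeights-nonNeg k [] = []
  scaleWeights-nonNeg k ((c , _) ∷ cs) =
    subst (ℚ._≤ toℚ c ℚ.* 1/suc k) (ℚ.*-zeroˡ (1/suc k)) (ℚ.*-monoʳ-≤-nonNeg (1/suc k) (toℚ-mono-≤ (z≤n {c})))
    ∷ scaleWeights-nonNeg k cs
    where
    instance
      1/suc-nonNeg : ℚ.NonNegative (1/suc k)
      1/suc-nonNeg = ℚ.nonNegative {1/suc k} (ℚ.*≤* (ℤ.+≤+ z≤n))

natCombination⇒¬IsVertex : ∀ {n} (p : Point) (cs : List (ℕ × Point)) k →
  All (λ c → InH n (proj₂ c) × proj₂ c ≢ p) cs →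
  natSum (const 1) cs ≡ suc k → natSum proj₁ cs ≡ suc k * proj₁ p → natSum proj₂ cs ≡ suc k * proj₂ p →
  ¬ IsVertex n p
natCombination⇒¬IsVertex p cs k others total≡ x≡ y≡ (_ , extreme) =
  extreme ws (Allₚ.map⁺ others)
    (scaleWeights-nonNeg k cs , trans (totalWeight≡wsum-1 ws) (normalised (const 1) total≡1)
    , normalised proj₁ x≡ , normalised proj₂ y≡)
  where
  ws : List (ℚ × Point)
  ws = scaleWeights (1/suc k) cs
  normalised : ∀ f {a} → natSum f cs ≡ suc k * a → wsum (toℚ ∘ f) ws ≡ toℚ a
  normalised f {a} eq =
    trans (wsum-scaleWeights f (1/suc k) cs) (trans (cong (λ s → toℚ s ℚ.* 1/suc k) eq) (suc*1/suc k a))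
  total≡1 : natSum (const 1) cs ≡ suc k * 1
  total≡1 = trans total≡ (sym (*-identityʳ (suc k)))

swapPoints : List (ℚ × Point) → List (ℚ × Point)
swapPoints = map (map₂ swap)

map-swapPoints : ∀ {A : Set} (f : ℚ × Point → A) ws → map f (swapPoints ws) ≡ map (f ∘ map₂ swap) ws
map-swapPoints f ws = sym (List.map-∘ ws)

InH-swap : ∀ {n} x y → InH n (x , y) → InH n (y , x)
InH-swap {n} x y = subst (n ≤_) (*-comm x y)

IsVertex-swap : ∀ {n x y} → IsVertex n (x , y) → IsVertex n (y , x)
IsVertex-swap {x = x} {y} (p∈H , extreme) = InH-swap x y p∈H , λ ws others (nonneg , total , xs , ys) →
  extreme (swapPoints ws)
    (Allₚ.map⁺ (All.map (λ {((_ , (a , b)))} (q∈H , q≢p) → InH-swap a b q∈H , q≢p ∘ cong swap) others))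
    ( Allₚ.map⁺ nonneg
    , trans (cong sumℚ (map-swapPoints proj₁ ws)) total
    , trans (cong sumℚ (map-swapPoints _ ws)) ys
    , trans (cong sumℚ (map-swapPoints _ ws)) xs)

∸-split : ∀ {p q r} → p ≤ q → q ≤ r → r ∸ p ≡ (q ∸ p) + (r ∸ q)
∸-split {p} {q} {r} p≤q q≤r = trans (cong (_∸ p) (sym (m+[n∸m]≡n q≤r))) (+-∸-comm (r ∸ q) p≤q)

verticalMidpoint⇒¬IsVertex : ∀ {n x y} → InH n (x , y) → InH n (x , suc (suc y)) → ¬ IsVertex n (x , suc y)
verticalMidpoint⇒¬IsVertex {x = x} {y} below above =
  natCombination⇒¬IsVertex (x , suc y) ((1 , (x , y)) ∷ (1 , (x , suc (suc y))) ∷ []) 1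
    ((below , 1+n≢n ∘ sym ∘ cong proj₂) ∷ (above , 1+n≢n ∘ cong proj₂) ∷ [])
    refl (double x) (sum-around y)
  where
  double : ∀ x → 1 * x + (1 * x + 0) ≡ 2 * x
  double = solve-∀
  sum-around : ∀ y → 1 * y + (1 * suc (suc y) + 0) ≡ 2 * suc y
  sum-around = solve-∀

-- The weights are d on p1, b on p2, and the slack of A d ≤ C b on the point just above p0.
belowChord-offsets : ∀ {n} x1 y2 b d C A → 1 ≤ b → 1 ≤ d → A * d ≤ C * b →
  InH n (x1 , y2 + C + A) → InH n (x1 + b + d , y2) → InH n (x1 + b , y2 + C) →
  ¬ IsVertex n (x1 + b , y2 + C)
belowChord-offsets x1 y2 b@(suc b-1) d@(suc d-1) C A _ _ slack p1∈H p2∈H p0∈H with m≤n⇒∃[o]m+o≡n slack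
... | E , A*d+E≡C*b = natCombination⇒¬IsVertex _ combination (d-1 + b + E)
  ((p1∈H , m+1+n≢m x1 ∘ sym ∘ cong proj₁)
   ∷ (p2∈H , m+1+n≢m (x1 + b) ∘ cong proj₁)
   ∷ (≤-trans p0∈H (*-monoʳ-≤ (x1 + b) (n≤1+n _)) , 1+n≢n ∘ cong proj₂) ∷ [])
  (weights d-1 b E) (abscissae x1 b-1 d-1 E) ordinates
  where
  combination : List (ℕ × Point)
  combination = (d , (x1 , y2 + C + A)) ∷ (b , (x1 + b + d , y2)) ∷ (E , (x1 + b , suc (y2 + C))) ∷ []
  weights : ∀ d-1 b E → suc d-1 * 1 + (b * 1 + (E * 1 + 0)) ≡ suc (d-1 + b + E)
  weights = solve-∀
  abscissae : ∀ x1 b-1 d-1 E → let b = suc b-1; d = suc d-1 in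
    d * x1 + (b * (x1 + b + d) + (E * (x1 + b) + 0)) ≡ suc (d-1 + b + E) * (x1 + b)
  abscissae = solve-∀
  expandˡ : ∀ y2 C A d b E → d * (y2 + C + A) + (b * y2 + (E * suc (y2 + C) + 0))
                            ≡ (d * (y2 + C) + b * y2 + E * (y2 + C)) + (A * d + E)
  expandˡ = solve-∀
  expandʳ : ∀ y2 C d-1 b E → suc (d-1 + b + E) * (y2 + C)
                            ≡ (suc d-1 * (y2 + C) + b * y2 + E * (y2 + C)) + C * b
  expandʳ = solve-∀
  ordinates : natSum proj₂ combination ≡ suc (d-1 + b + E) * (y2 + C)
  ordinates = begin
    natSum proj₂ combination                                   ≡⟨ expandˡ y2 C A d b E ⟩
    (d * (y2 + C) + b * y2 + E * (y2 + C)) + (A * d + E)       ≡⟨ cong ((d * (y2 + C) + b * y2 + E * (y2 + C)) +_) A*d+E≡C*b ⟩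
    (d * (y2 + C) + b * y2 + E * (y2 + C)) + C * b             ≡⟨ expandʳ y2 C d-1 b E ⟨
    suc (d-1 + b + E) * (y2 + C)                               ∎
    where open ≡-Reasoning

belowChord⇒¬IsVertex : ∀ {n x1 x0 x2 y1 y0 y2} → x1 < x0 → x0 < x2 → y0 ≤ y1 → y2 ≤ y0 →
  InH n (x1 , y1) → InH n (x2 , y2) → InH n (x0 , y0) →
  (y1 ∸ y0) * (x2 ∸ x0) ≤ (y0 ∸ y2) * (x0 ∸ x1) → ¬ IsVertex n (x0 , y0)
belowChord⇒¬IsVertex {x1 = x1} {y2 = y2} x1<x0 x0<x2 y0≤y1 y2≤y0 p1∈H p2∈H p0∈H below
  with m≤n⇒∃[o]m+o≡n (<⇒≤ x1<x0) | m≤n⇒∃[o]m+o≡n (<⇒≤ x0<x2) | m≤n⇒∃[o]m+o≡n y0≤y1 | m≤n⇒∃[o]m+o≡n y2≤y0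
... | b , refl | d , refl | A , refl | C , refl =
  belowChord-offsets x1 y2 b d C A (positiveOffset x1<x0) (positiveOffset x0<x2) slack p1∈H p2∈H p0∈H
  where
  positiveOffset : ∀ {m k} → m < m + k → 1 ≤ k
  positiveOffset {m} {k} m<m+k = subst (1 ≤_) (m+n∸m≡n m k) (m<n⇒0<n∸m m<m+k)
  slack : A * d ≤ C * b
  slack = subst₂ _≤_ (cong₂ _*_ (m+n∸m≡n (y2 + C) A) (m+n∸m≡n (x1 + b) d))
                     (cong₂ _*_ (m+n∸m≡n y2 C) (m+n∸m≡n x1 b)) below

-- If P2 − P1 = P4 − P3, one of P2, P3 lies on or below the chord P1P4.
equalEdges⇒¬IsVertex : ∀ {n x1 x2 x3 x4 y1 y2 y3 y4} → x1 < x2 → x2 ≤ x3 → x3 < x4 →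
  y4 ≤ y3 → y3 ≤ y2 → y2 ≤ y1 → x2 ∸ x1 ≡ x4 ∸ x3 → y1 ∸ y2 ≡ y3 ∸ y4 →
  InH n (x1 , y1) → InH n (x4 , y4) → IsVertex n (x2 , y2) → IsVertex n (x3 , y3) → ⊥
equalEdges⇒¬IsVertex {n} {x1} {x2} {x3} {x4} {y1} {y2} {y3} {y4}
  x1<x2 x2≤x3 x3<x4 y4≤y3 y3≤y2 y2≤y1 width≡ height≡ p1∈H p4∈H v2 v3 =
  [ P2-notVertex , P3-notVertex ] (≤-total (b * u) (v * a))
  where
  a u b v : ℕ
  a = x2 ∸ x1
  u = x3 ∸ x2
  b = y1 ∸ y2
  v = y2 ∸ y3
  P2-below : b * u ≤ v * a → (y1 ∸ y2) * (x4 ∸ x2) ≤ (y2 ∸ y4) * (x2 ∸ x1)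
  P2-below bu≤va = begin
    b * (x4 ∸ x2)           ≡⟨ cong (b *_) (trans (∸-split x2≤x3 (<⇒≤ x3<x4)) (cong (u +_) (sym width≡))) ⟩
    b * (u + a)             ≡⟨ *-distribˡ-+ b u a ⟩
    b * u + b * a           ≤⟨ +-monoˡ-≤ (b * a) bu≤va ⟩
    v * a + b * a           ≡⟨ *-distribʳ-+ a v b ⟨
    (v + b) * a             ≡⟨ cong (_* a) (+-comm v b) ⟩
    (b + v) * a             ≡⟨ cong (λ h → (h + v) * a) height≡ ⟩
    ((y3 ∸ y4) + v) * a     ≡⟨ cong (_* a) (∸-split y4≤y3 y3≤y2) ⟨
    (y2 ∸ y4) * a           ∎
    where open ≤-Reasoning
  P3-below : v * a ≤ b * u → (y1 ∸ y3) * (x4 ∸ x3) ≤ (y3 ∸ y4) * (x3 ∸ x1)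
  P3-below va≤bu = begin
    (y1 ∸ y3) * (x4 ∸ x3)   ≡⟨ cong₂ _*_ (∸-split y3≤y2 y2≤y1) (sym width≡) ⟩
    (v + b) * a             ≡⟨ *-distribʳ-+ a v b ⟩
    v * a + b * a           ≤⟨ +-monoˡ-≤ (b * a) va≤bu ⟩
    b * u + b * a           ≡⟨ *-distribˡ-+ b u a ⟨
    b * (u + a)             ≡⟨ cong₂ _*_ height≡ (+-comm u a) ⟩
    (y3 ∸ y4) * (a + u)     ≡⟨ cong ((y3 ∸ y4) *_) (∸-split (<⇒≤ x1<x2) x2≤x3) ⟨
    (y3 ∸ y4) * (x3 ∸ x1)   ∎
    where open ≤-Reasoning
  P2-notVertex : b * u ≤ v * a → ⊥
  P2-notVertex bu≤va = belowChord⇒¬IsVertex x1<x2 (≤-<-trans x2≤x3 x3<x4) y2≤y1 (≤-trans y4≤y3 y3≤y2)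
    p1∈H p4∈H (proj₁ v2) (P2-below bu≤va) v2
  P3-notVertex : v * a ≤ b * u → ⊥
  P3-notVertex va≤bu = belowChord⇒¬IsVertex (<-≤-trans x1<x2 x2≤x3) x3<x4 (≤-trans y3≤y2 y2≤y1) y4≤y3
    p1∈H p4∈H (proj₁ v3) (P3-below va≤bu) v3

-- The boundary ⌈n/x⌉ of H_n ∩ ℤ²

⌈_/_⌉ : ℕ → ℕ → ℕ
⌈ n / zero ⌉ = 0
⌈ n / suc k ⌉ = (n + k) / suc k

n≤x*⌈n/x⌉ : ∀ n {x} → 1 ≤ x → n ≤ x * ⌈ n / x ⌉
n≤x*⌈n/x⌉ n {suc k} _ = +-cancelʳ-≤ k n (suc k * ⌈ n / suc k ⌉) (begin
  n + k                                ≡⟨ m≡m%n+[m/n]*n (n + k) (suc k) ⟩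
  (n + k) % suc k + ⌈ n / suc k ⌉ * suc k ≤⟨ +-monoˡ-≤ _ (≤-pred (m%n<n (n + k) (suc k))) ⟩
  k + ⌈ n / suc k ⌉ * suc k            ≡⟨ +-comm k _ ⟩
  ⌈ n / suc k ⌉ * suc k + k            ≡⟨ cong (_+ k) (*-comm ⌈ n / suc k ⌉ (suc k)) ⟩
  suc k * ⌈ n / suc k ⌉ + k            ∎)
  where open ≤-Reasoning

x*⌈n/x⌉<n+x : ∀ n {x} → 1 ≤ x → x * ⌈ n / x ⌉ < n + x
x*⌈n/x⌉<n+x n {suc k} _ = begin-strict
  suc k * ⌈ n / suc k ⌉                ≡⟨ *-comm (suc k) _ ⟩
  ⌈ n / suc k ⌉ * suc k                ≤⟨ m≤n+m _ _ ⟩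
  (n + k) % suc k + ⌈ n / suc k ⌉ * suc k ≡⟨ m≡m%n+[m/n]*n (n + k) (suc k) ⟨
  n + k                                <⟨ +-monoʳ-< n (n<1+n k) ⟩
  n + suc k                            ∎
  where open ≤-Reasoning

⌈n/x⌉-least : ∀ {n x y} → 1 ≤ x → n ≤ x * y → ⌈ n / x ⌉ ≤ y
⌈n/x⌉-least {n} {x} {y} 1≤x n≤xy = ≮⇒≥ λ y<⌈n/x⌉ → n≮n (n + x) (begin-strict
  n + x        ≤⟨ +-monoˡ-≤ x n≤xy ⟩
  x * y + x    ≡⟨ +-comm (x * y) x ⟩
  x + x * y    ≡⟨ *-suc x y ⟨
  x * suc y    ≤⟨ *-monoʳ-≤ x y<⌈n/x⌉ ⟩
  x * ⌈ n / x ⌉ <⟨ x*⌈n/x⌉<n+x n 1≤x ⟩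
  n + x        ∎)
  where open ≤-Reasoning

⌈n/x⌉-antitone : ∀ n {x x'} → 1 ≤ x → x ≤ x' → ⌈ n / x' ⌉ ≤ ⌈ n / x ⌉
⌈n/x⌉-antitone n {x} 1≤x x≤x' =
  ⌈n/x⌉-least (≤-trans 1≤x x≤x') (≤-trans (n≤x*⌈n/x⌉ n 1≤x) (*-monoˡ-≤ ⌈ n / x ⌉ x≤x'))

1≤⌈n/x⌉ : ∀ {n x} → 1 ≤ n → 1 ≤ x → 1 ≤ ⌈ n / x ⌉
1≤⌈n/x⌉ {n} {x} 1≤n 1≤x = ≮⇒≥ λ ⌈n/x⌉<1 → <⇒≱ 1≤n (begin
  n             ≤⟨ n≤x*⌈n/x⌉ n 1≤x ⟩
  x * ⌈ n / x ⌉ ≤⟨ *-monoʳ-≤ x (≤-pred ⌈n/x⌉<1) ⟩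
  x * 0         ≡⟨ *-zeroʳ x ⟩
  0             ∎)
  where open ≤-Reasoning

⌈n/n⌉≡1 : ∀ {n} → 1 ≤ n → ⌈ n / n ⌉ ≡ 1
⌈n/n⌉≡1 {n} 1≤n = ≤-antisym (⌈n/x⌉-least 1≤n (≤-reflexive (sym (*-identityʳ n)))) (1≤⌈n/x⌉ 1≤n 1≤n)

2≤⌈n/x⌉ : ∀ {n x} → 1 ≤ x → x < n → 2 ≤ ⌈ n / x ⌉
2≤⌈n/x⌉ {n} {x} 1≤x x<n = ≮⇒≥ λ ⌈n/x⌉<2 → <⇒≱ x<n (begin
  n             ≤⟨ n≤x*⌈n/x⌉ n 1≤x ⟩
  x * ⌈ n / x ⌉ ≤⟨ *-monoʳ-≤ x (≤-pred ⌈n/x⌉<2) ⟩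
  x * 1         ≡⟨ *-identityʳ x ⟩
  x             ∎)
  where open ≤-Reasoning

-- Slopes and supporting lines

linear-mono-≤ : ∀ α β {x x' y y'} → x ≤ x' → y ≤ y' → linear α β (x , y) ≤ linear α β (x' , y')
linear-mono-≤ α β x≤x' y≤y' = +-mono-≤ (*-monoʳ-≤ α x≤x') (*-monoʳ-≤ β y≤y')

linear-<-upLeft : ∀ α β {x1 x0 y0 y1} → x1 ≤ x0 → y0 ≤ y1 →
  α * (x0 ∸ x1) < β * (y1 ∸ y0) → linear α β (x0 , y0) < linear α β (x1 , y1)
linear-<-upLeft α β {x1} {y0 = y0} x1≤x0 y0≤y1 trade
  with m≤n⇒∃[o]m+o≡n x1≤x0 | m≤n⇒∃[o]m+o≡n y0≤y1
... | B , refl | A , refl = begin-strict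
  α * (x1 + B) + β * y0         ≡⟨ split α β x1 B y0 ⟩
  (α * x1 + β * y0) + α * B     <⟨ +-monoʳ-< _ (subst₂ (λ u v → α * u < β * v) (m+n∸m≡n x1 B) (m+n∸m≡n y0 A) trade) ⟩
  (α * x1 + β * y0) + β * A     ≡⟨ split′ α β x1 y0 A ⟨
  α * x1 + β * (y0 + A)         ∎
  where
  open ≤-Reasoning
  split : ∀ α β x B y → α * (x + B) + β * y ≡ (α * x + β * y) + α * B
  split = solve-∀
  split′ : ∀ α β x y A → α * x + β * (y + A) ≡ (α * x + β * y) + β * A
  split′ = solve-∀

linear-<-downRight : ∀ α β {x0 x2 y0 y2} → x0 ≤ x2 → y2 ≤ y0 →
  β * (y0 ∸ y2) < α * (x2 ∸ x0) → linear α β (x0 , y0) < linear α β (x2 , y2)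
linear-<-downRight α β x0≤x2 y2≤y0 trade =
  subst₂ _<_ (+-comm (β * _) (α * _)) (+-comm (β * _) (α * _)) (linear-<-upLeft β α y2≤y0 x0≤x2 trade)

cross-≤-trans : ∀ {p1 q1 p2 q2 p3 q3} → 1 ≤ q2 → p1 * q2 ≤ p2 * q1 → p2 * q3 ≤ p3 * q2 → p1 * q3 ≤ p3 * q1
cross-≤-trans {p1} {q1} {p2} {q2@(suc _)} {p3} {q3} _ ≤₁ ≤₂ = *-cancelʳ-≤ (p1 * q3) (p3 * q1) q2 (begin
  p1 * q3 * q2  ≡⟨ reorder p1 q3 q2 ⟩
  p1 * q2 * q3  ≤⟨ *-monoˡ-≤ q3 ≤₁ ⟩
  p2 * q1 * q3  ≡⟨ reorder p2 q1 q3 ⟩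
  p2 * q3 * q1  ≤⟨ *-monoˡ-≤ q1 ≤₂ ⟩
  p3 * q2 * q1  ≡⟨ reorder p3 q2 q1 ⟩
  p3 * q1 * q2  ∎)
  where
  open ≤-Reasoning
  reorder : ∀ a b c → a * b * c ≡ a * c * b
  reorder = solve-∀

-- (A D + C B) / (2 B D) is the mean of the fractions C/D < A/B.
mean<fraction : ∀ A B C D P Q → 1 ≤ Q → C * B < A * D → A * Q ≤ P * B →
  (A * D + C * B) * Q < (2 * B * D) * P
mean<fraction A B C D P Q 1≤Q C/D<A/B A/B≤P/Q = begin-strict
  (A * D + C * B) * Q       ≡⟨ expand A D C B Q ⟩
  A * Q * D + C * B * Q     <⟨ +-monoʳ-< (A * Q * D) (*-monoˡ-< Q {{>-nonZero 1≤Q}} C/D<A/B) ⟩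
  A * Q * D + A * D * Q     ≡⟨ cong (A * Q * D +_) (reorder A D Q) ⟩
  A * Q * D + A * Q * D     ≤⟨ +-mono-≤ (*-monoˡ-≤ D A/B≤P/Q) (*-monoˡ-≤ D A/B≤P/Q) ⟩
  P * B * D + P * B * D     ≡⟨ double P B D ⟩
  2 * B * D * P             ∎
  where
  open ≤-Reasoning
  expand : ∀ A D C B Q → (A * D + C * B) * Q ≡ A * Q * D + C * B * Q
  expand = solve-∀
  reorder : ∀ a b c → a * b * c ≡ a * c * b
  reorder = solve-∀
  double : ∀ P B D → P * B * D + P * B * D ≡ 2 * B * D * P
  double = solve-∀

mean>fraction : ∀ A B C D P Q → 1 ≤ Q → C * B < A * D → P * D ≤ C * Q →
  (2 * B * D) * P < (A * D + C * B) * Q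
mean>fraction A B C D P Q 1≤Q C/D<A/B P/Q≤C/D = begin-strict
  2 * B * D * P             ≡⟨ double B D P ⟩
  B * (P * D) + B * (P * D) ≤⟨ +-mono-≤ (*-monoʳ-≤ B P/Q≤C/D) (*-monoʳ-≤ B P/Q≤C/D) ⟩
  B * (C * Q) + B * (C * Q) ≡⟨ cong (B * (C * Q) +_) (rotate B C Q) ⟩
  B * (C * Q) + C * B * Q   <⟨ +-monoʳ-< (B * (C * Q)) (*-monoˡ-< Q {{>-nonZero 1≤Q}} C/D<A/B) ⟩
  B * (C * Q) + A * D * Q   ≡⟨ collect A D C B Q ⟩
  (A * D + C * B) * Q       ∎
  where
  open ≤-Reasoning
  double : ∀ B D P → 2 * B * D * P ≡ B * (P * D) + B * (P * D)
  double = solve-∀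
  rotate : ∀ B C Q → B * (C * Q) ≡ C * B * Q
  rotate = solve-∀
  collect : ∀ A D C B Q → B * (C * Q) + A * D * Q ≡ (A * D + C * B) * Q
  collect = solve-∀

m+o≤n⇒m/o<n/o : ∀ m n o .{{_ : NonZero o}} → m + o ≤ n → m / o < n / o
m+o≤n⇒m/o<n/o m n o m+o≤n = begin-strict
  m / o             <⟨ n<1+n (m / o) ⟩
  suc (m / o)       ≡⟨ cong (λ k → suc (k / o)) (m+n∸n≡m m o) ⟨
  suc ((m + o ∸ o) / o) ≡⟨ m/n≡1+[m∸n]/n (m≤n+m o m) ⟨
  (m + o) / o       ≤⟨ /-monoˡ-≤ o m+o≤n ⟩
  n / o             ∎
  where open ≤-Reasoning

m<n*[1+m/n] : ∀ m n .{{_ : NonZero n}} → m < n * suc (m / n)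
m<n*[1+m/n] m n = begin-strict
  m                     ≡⟨ m≡m%n+[m/n]*n m n ⟩
  m % n + m / n * n     <⟨ +-monoˡ-< (m / n * n) (m%n<n m n) ⟩
  n + m / n * n         ≡⟨ cong (n +_) (*-comm (m / n) n) ⟩
  n + n * (m / n)       ≡⟨ *-suc n (m / n) ⟨
  n * suc (m / n)       ∎
  where open ≤-Reasoning

m∸1<m : ∀ {m} → 1 ≤ m → m ∸ 1 < m
m∸1<m {suc m} _ = n<1+n m

[m∸1]*n+n≡m*n : ∀ {m n} → 1 ≤ m → (m ∸ 1) * n + n ≡ m * n
[m∸1]*n+n≡m*n {suc m} {n} _ = +-comm (m * n) n

mixedRadix-< : ∀ {q Q r W} → q < Q → r < W → q * W + r < Q * W
mixedRadix-< {q} {Q} {r} {W} q<Q r<W = begin-strict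
  q * W + r   <⟨ +-monoʳ-< (q * W) r<W ⟩
  q * W + W   ≡⟨ +-comm (q * W) W ⟩
  suc q * W   ≤⟨ *-monoˡ-≤ W q<Q ⟩
  Q * W       ∎
  where open ≤-Reasoning

mixedRadix-injective : ∀ {W} q q' {r r'} → r < W → r' < W → q * W + r ≡ q' * W + r' → q ≡ q' × r ≡ r'
mixedRadix-injective {W} q q' {r} {r'} r<W r'<W eq with <-cmp q q'
... | tri< q<q' _ _ = contradiction eq (<⇒≢ (<-≤-trans (mixedRadix-< q<q' r<W) (m≤m+n (q' * W) r')))
... | tri> _ _ q'<q = contradiction (sym eq) (<⇒≢ (<-≤-trans (mixedRadix-< q'<q r'<W) (m≤m+n (q * W) r)))
... | tri≈ _ refl _ = refl , +-cancelˡ-≡ (q * W) r r' eq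

-- α / β = n / (x0 (x0 + 1)) + 1: the level line through (x0 , n / x0) is steeper than the chord of y = n / x
-- from x0 to x0 + 1 and, when x0³ < n, flatter than the chord from x0 − 1 by enough to absorb the rounding up.
supportingβ : ℕ → ℕ
supportingβ x0 = x0 * suc x0

supportingα : ℕ → ℕ → ℕ
supportingα n x0 = n + supportingβ x0

private
  supporting-right : ∀ n x0 e → let α = supportingα n x0; β = supportingβ x0; x = suc (x0 + e) in
    α * x * x0 * x0 + β * x * (n + x0) ≤ α * x * x * x0 + β * x0 * n
  supporting-right n x0 e = begin
    α * x * x0 * x0 + β * x * (n + x0)
      ≡⟨ separate α β x0 e n ⟩
    (α * x * x0 * x0 + β * x0 * n) + (β * suc e * n + β * x * x0)
      ≤⟨ +-monoʳ-≤ (α * x * x0 * x0 + β * x0 * n)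
           (+-mono-≤ (*-monoˡ-≤ n (*-monoˡ-≤ (suc e) β≤x*x0)) (m≤m*n (β * x * x0) (suc e))) ⟩
    (α * x * x0 * x0 + β * x0 * n) + (x * x0 * suc e * n + β * x * x0 * suc e)
      ≡⟨ recombine n β x0 e ⟩
    α * x * x * x0 + β * x0 * n ∎
    where
    open ≤-Reasoning
    α β x : ℕ
    α = supportingα n x0
    β = supportingβ x0
    x = suc (x0 + e)
    β≤x*x0 : β ≤ x * x0
    β≤x*x0 = ≤-trans (*-monoʳ-≤ x0 (s≤s (m≤m+n x0 e))) (≤-reflexive (*-comm x0 x))
    separate : ∀ α β x0 e n → let x = suc (x0 + e) in
      α * x * x0 * x0 + β * x * (n + x0) ≡ (α * x * x0 * x0 + β * x0 * n) + (β * suc e * n + β * x * x0)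
    separate = solve-∀
    recombine : ∀ n β x0 e → let x = suc (x0 + e) in
      ((n + β) * x * x0 * x0 + β * x0 * n) + (x * x0 * suc e * n + β * x * x0 * suc e)
      ≡ (n + β) * x * x * x0 + β * x0 * n
    recombine = solve-∀

  supporting-left : ∀ n x e → let x0 = suc (x + e); α = supportingα n x0; β = supportingβ x0 in
    x0 ^ 3 < n → α * x * x0 * x0 + β * x * (n + x0) ≤ α * x * x * x0 + β * x0 * n
  supporting-left n x e x0^3<n = begin
    α * x * x0 * x0 + β * x * (n + x0)
      ≡⟨ separate n β x e ⟩
    (α * x * x * x0 + β * x * n + n * x * x0 * suc e) + β * x * (x0 * suc (suc e))
      ≤⟨ +-monoʳ-≤ (α * x * x * x0 + β * x * n + n * x * x0 * suc e) (*-monoˡ-≤ (x0 * suc (suc e)) β*x≤[1+e]*n) ⟩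
    (α * x * x * x0 + β * x * n + n * x * x0 * suc e) + suc e * n * (x0 * suc (suc e))
      ≡⟨ recombine n x e ⟩
    α * x * x * x0 + β * x0 * n ∎
    where
    open ≤-Reasoning
    α β x0 : ℕ
    x0 = suc (x + e)
    α = supportingα n x0
    β = supportingβ x0
    expand-square : ∀ x e → let x0 = suc (x + e) in x0 * (x0 * 1) ≡ suc x0 * x + (e * x + suc e * suc e)
    expand-square = solve-∀
    β*x≤x0^3 : β * x ≤ x0 ^ 3
    β*x≤x0^3 = begin
      x0 * suc x0 * x   ≡⟨ *-assoc x0 (suc x0) x ⟩
      x0 * (suc x0 * x) ≤⟨ *-monoʳ-≤ x0 (≤-trans (m≤m+n (suc x0 * x) _) (≤-reflexive (sym (expand-square x e)))) ⟩
      x0 ^ 3            ∎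
    β*x≤[1+e]*n : β * x ≤ suc e * n
    β*x≤[1+e]*n = ≤-trans (<⇒≤ (≤-<-trans β*x≤x0^3 x0^3<n)) (m≤n*m n (suc e))
    separate : ∀ n β x e → let x0 = suc (x + e) in
      (n + β) * x * x0 * x0 + β * x * (n + x0)
      ≡ ((n + β) * x * x * x0 + β * x * n + n * x * x0 * suc e) + β * x * (x0 * suc (suc e))
    separate = solve-∀
    recombine : ∀ n x e → let x0 = suc (x + e); β = x0 * suc x0 in
      ((n + β) * x * x * x0 + β * x * n + n * x * x0 * suc e) + suc e * n * (x0 * suc (suc e))
      ≡ (n + β) * x * x * x0 + β * x0 * n
    recombine = solve-∀

-- α x0 + β (n + x0) / x0 ≤ α x + β n / x, multiplied by x x0.
supporting-cleared : ∀ n {x0 x} → x ≢ x0 → x0 ^ 3 < n → let α = supportingα n x0; β = supportingβ x0 in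
  α * x * x0 * x0 + β * x * (n + x0) ≤ α * x * x * x0 + β * x0 * n
supporting-cleared n {x0} {x} x≢x0 x0^3<n with <-cmp x x0
... | tri≈ _ x≡x0 _ = contradiction x≡x0 x≢x0
... | tri< x<x0 _ _ with m≤n⇒∃[o]m+o≡n x<x0
...   | e , refl = supporting-left n x e x0^3<n
supporting-cleared n {x0} {x} x≢x0 x0^3<n | tri> _ _ x0<x with m≤n⇒∃[o]m+o≡n x0<x
...   | e , refl = supporting-right n x0 e

-- Bounded search and counting

module _ {_≼_ : ℕ → ℕ → Set} (_≼?_ : ∀ a b → Dec (a ≼ b)) (≼-refl : ∀ {a} → a ≼ a)
         (≼-total : ∀ {a b} → ¬ a ≼ b → b ≼ a) {lo hi : ℕ}
         (≼-trans : ∀ {a b c} → lo ≤ b → b ≤ hi → a ≼ b → b ≼ c → a ≼ c) where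

  minimiser : lo ≤ hi → ∃ λ m → lo ≤ m × m ≤ hi × (∀ {z} → lo ≤ z → z ≤ hi → m ≼ z)
  minimiser lo≤hi = minimiserUpTo hi lo≤hi ≤-refl
    where
    upToSuc : ∀ {P : ℕ → Set} {h} → (∀ {z} → lo ≤ z → z ≤ h → P z) → P (suc h) →
      ∀ {z} → lo ≤ z → z ≤ suc h → P z
    upToSuc below top lo≤z z≤1+h with m≤n⇒m<n∨m≡n z≤1+h
    ... | inj₁ z<1+h = below lo≤z (≤-pred z<1+h)
    ... | inj₂ refl = top
    minimiserUpTo : ∀ h → lo ≤ h → h ≤ hi → ∃ λ m → lo ≤ m × m ≤ h × (∀ {z} → lo ≤ z → z ≤ h → m ≼ z)
    minimiserUpTo h lo≤h h≤hi with m≤n⇒m<n∨m≡n lo≤h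
    ... | inj₂ lo≡h = h , lo≤h , ≤-refl , λ lo≤z z≤h →
      subst (h ≼_) (≤-antisym (subst (_≤ _) lo≡h lo≤z) z≤h) ≼-refl
    minimiserUpTo (suc h) lo≤1+h 1+h≤hi | inj₁ (s≤s lo≤h)
      with minimiserUpTo h lo≤h (≤-trans (n≤1+n h) 1+h≤hi)
    ... | m , lo≤m , m≤h , least with m ≼? suc h
    ...   | yes m≼1+h = m , lo≤m , m≤n⇒m≤1+n m≤h , upToSuc least m≼1+h
    ...   | no m⋠1+h = suc h , lo≤1+h , ≤-refl , upToSuc
      (λ lo≤z z≤h → ≼-trans lo≤m (≤-trans m≤h (≤-trans (n≤1+n h) 1+h≤hi)) (≼-total m⋠1+h) (least lo≤z z≤h))
      ≼-refl

module _ {P : ℕ → Set} (P? : ∀ k → Dec (P k)) where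

  leastWitness : ∀ k → P k → ∃ λ m → m ≤ k × P m × (∀ {j} → j < m → ¬ P j)
  leastWitness k Pk = below k ≤-refl Pk
    where
    below : ∀ bound {k} → k ≤ bound → P k → ∃ λ m → m ≤ k × P m × (∀ {j} → j < m → ¬ P j)
    below bound {k} k≤bound Pk with anyUpTo? P? k
    ... | no none = k , ≤-refl , Pk , λ j<k Pj → none (_ , j<k , Pj)
    below zero {zero} _ _ | yes (_ , () , _)
    below (suc bound) k≤1+bound _ | yes (j , j<k , Pj) =
      let m , m≤j , Pm , least = below bound (≤-pred (<-≤-trans j<k k≤1+bound)) Pj
      in m , ≤-trans m≤j (<⇒≤ j<k) , Pm , least

n≤n^3 : ∀ n → n ≤ n ^ 3
n≤n^3 zero = z≤n
n≤n^3 (suc n) = m≤m*n (suc n) (suc n ^ 2) {{m^n≢0 (suc n) 2}}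

⌈∛_⌉ : ℕ → ℕ
⌈∛ n ⌉ = proj₁ (leastWitness (λ c → n ≤? c ^ 3) n (n≤n^3 n))

n≤⌈∛n⌉^3 : ∀ n → n ≤ ⌈∛ n ⌉ ^ 3
n≤⌈∛n⌉^3 n = proj₁ (proj₂ (proj₂ (leastWitness (λ c → n ≤? c ^ 3) n (n≤n^3 n))))

x<⌈∛n⌉⇒x^3<n : ∀ {n x} → x < ⌈∛ n ⌉ → x ^ 3 < n
x<⌈∛n⌉⇒x^3<n {n} x<c = ≰⇒> (proj₂ (proj₂ (proj₂ (leastWitness (λ c → n ≤? c ^ 3) n (n≤n^3 n)))) x<c)

1≤⌈∛n⌉ : ∀ {n} → 1 ≤ n → 1 ≤ ⌈∛ n ⌉
1≤⌈∛n⌉ {n} 1≤n = ≮⇒≥ λ c<1 → <⇒≱ 1≤n (subst (λ c → n ≤ c ^ 3) (n<1⇒n≡0 c<1) (n≤⌈∛n⌉^3 n))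

[1+k]^3≤8*k^3 : ∀ {k} → 1 ≤ k → suc k ^ 3 ≤ 8 * k ^ 3
[1+k]^3≤8*k^3 {k} 1≤k = begin
  suc k ^ 3          ≤⟨ ^-monoˡ-≤ 3 1+k≤2k ⟩
  (2 * k) ^ 3        ≡⟨ cube-double k ⟩
  8 * k ^ 3          ∎
  where
  open ≤-Reasoning
  1+k≤2k : suc k ≤ 2 * k
  1+k≤2k = subst₂ _≤_ (+-comm k 1) (cong (k +_) (sym (+-identityʳ k))) (+-monoʳ-≤ k 1≤k)
  cube-double : ∀ k → (2 * k) * ((2 * k) * ((2 * k) * 1)) ≡ 8 * (k * (k * (k * 1)))
  cube-double = solve-∀

⌈∛n⌉^3≤8*n : ∀ {n} → 1 ≤ n → ⌈∛ n ⌉ ^ 3 ≤ 8 * n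
⌈∛n⌉^3≤8*n {n} 1≤n with ⌈∛ n ⌉ | 1≤⌈∛n⌉ 1≤n | x<⌈∛n⌉⇒x^3<n {n}
... | suc zero    | _ | _ = ≤-trans 1≤n (m≤n*m n 8)
... | suc (suc k) | _ | below = ≤-trans ([1+k]^3≤8*k^3 {suc k} (s≤s z≤n)) (*-monoʳ-≤ 8 (<⇒≤ (below {suc k} ≤-refl)))

lgData : ∀ x → ∃ λ k → k ≤ x × x < 2 ^ suc k × (∀ {j} → j < k → ¬ x < 2 ^ suc j)
lgData x = leastWitness (λ k → x <? 2 ^ suc k) x (<-trans (n<2^n x) (^-monoʳ-< 2 (s≤s (s≤s z≤n)) (n<1+n x)))
  where
  n<2^n : ∀ x → x < 2 ^ x
  n<2^n zero = s≤s z≤n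
  n<2^n (suc x) = ≤-<-trans (n<2^n x) (m<m+n (2 ^ x) (≤-trans (m^n>0 2 x) (m≤m+n (2 ^ x) 0)))

-- lg x = ⌊log₂ x⌋ for x ≥ 1
lg : ℕ → ℕ
lg x = proj₁ (lgData x)

2^lg≤x : ∀ {x} → 1 ≤ x → 2 ^ lg x ≤ x
2^lg≤x {x} 1≤x with lgData x
... | zero , _ , _ , _ = 1≤x
... | suc j , _ , _ , least = ≮⇒≥ (least ≤-refl)

x<2^[1+lg] : ∀ x → x < 2 ^ suc (lg x)
x<2^[1+lg] x = proj₁ (proj₂ (proj₂ (lgData x)))

∈-─ : ∀ {A : Set} {x z : A} {ys} (x∈ys : x ∈ ys) → z ∈ ys → z ≢ x → z ∈ ys ─ x∈ys
∈-─ (here refl) (here refl) z≢x = contradiction refl z≢x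
∈-─ (here _) (there z∈ys) _ = z∈ys
∈-─ (there _) (here refl) _ = here refl
∈-─ (there x∈ys) (there z∈ys) z≢x = there (∈-─ x∈ys z∈ys z≢x)

Unique-⊆⇒length-≤ : ∀ {A : Set} {xs ys : List A} → Unique xs → xs ⊆ ys → length xs ≤ length ys
Unique-⊆⇒length-≤ {xs = []} _ _ = z≤n
Unique-⊆⇒length-≤ {xs = x ∷ xs} {ys} (x∉xs ∷ unique) xs⊆ys = begin
  suc (length xs)          ≤⟨ s≤s (Unique-⊆⇒length-≤ unique (λ z∈xs →
                                ∈-─ x∈ys (xs⊆ys (there z∈xs)) (All.lookup x∉xs z∈xs ∘ sym))) ⟩
  suc (length (ys ─ x∈ys)) ≡⟨ List.length-removeAt′ ys (Any.index x∈ys) ⟨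
  length ys                ∎
  where
  open ≤-Reasoning
  x∈ys : x ∈ ys
  x∈ys = xs⊆ys (here refl)

Unique-map⁺ : ∀ {A B : Set} {f : A → B} {xs} → (∀ {x y} → x ∈ xs → y ∈ xs → f x ≡ f y → x ≡ y) →
  Unique xs → Unique (map f xs)
Unique-map⁺ {xs = []} _ [] = []
Unique-map⁺ {f = f} {x ∷ xs} injective (x∉xs ∷ unique) =
  Allₚ.map⁺ (All.tabulate λ y∈xs fx≡fy → All.lookup x∉xs y∈xs (injective (here refl) (there y∈xs) fx≡fy))
  ∷ Unique-map⁺ (λ x∈ y∈ → injective (there x∈) (there y∈)) unique

injectionBelow⇒length-≤ : ∀ {A : Set} (f : A → ℕ) N {xs} → Unique xs → (∀ {x} → x ∈ xs → f x < N) →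
  (∀ {x y} → x ∈ xs → y ∈ xs → f x ≡ f y → x ≡ y) → length xs ≤ N
injectionBelow⇒length-≤ f N {xs} unique below injective = begin
  length xs          ≡⟨ List.length-map f xs ⟨
  length (map f xs)  ≤⟨ Unique-⊆⇒length-≤ (Unique-map⁺ injective unique) codes⊆ ⟩
  length (upTo N)    ≡⟨ List.length-upTo N ⟩
  N                  ∎
  where
  open ≤-Reasoning
  codes⊆ : map f xs ⊆ upTo N
  codes⊆ fx∈ with ∈.∈-map⁻ f fx∈
  ... | x , x∈xs , refl = ∈.∈-upTo⁺ (below x∈xs)

-- Vertices

boundaryPoint : ℕ → ℕ → Point
boundaryPoint n x = x , ⌈ n / x ⌉

-- The boundary is steeper on [x1 , x0] than on [x0 , x2] (slopes cross-multiplied).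
ConvexTriple : ℕ → ℕ → ℕ → ℕ → Set
ConvexTriple n x1 x0 x2 = (⌈ n / x0 ⌉ ∸ ⌈ n / x2 ⌉) * (x0 ∸ x1) < (⌈ n / x1 ⌉ ∸ ⌈ n / x0 ⌉) * (x2 ∸ x0)

-- Quantifying over x1 < x0 and x2 < n + 1 keeps this decidable.
StrictlyConvexAt : ℕ → ℕ → Set
StrictlyConvexAt n x0 = ∀ {x1} → x1 < x0 → 1 ≤ x1 → ∀ {x2} → x2 < suc n → x0 < x2 → ConvexTriple n x1 x0 x2

strictlyConvexAt? : ∀ n x0 → Dec (StrictlyConvexAt n x0)
strictlyConvexAt? n x0 =
  allUpTo? (λ x1 → (1 ≤? x1) →-dec allUpTo? (λ x2 → (x0 <? x2) →-dec (_ <? _)) (suc n)) x0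

boundaryPoint∈H : ∀ {n x} → 1 ≤ x → InH n (boundaryPoint n x)
boundaryPoint∈H {n} = n≤x*⌈n/x⌉ n

positiveStrictlyConvexAt? : ∀ n x → Dec (1 ≤ x × StrictlyConvexAt n x)
positiveStrictlyConvexAt? n x = (1 ≤? x) ×-dec strictlyConvexAt? n x

vertexAbscissae : ℕ → List ℕ
vertexAbscissae n = filter (positiveStrictlyConvexAt? n) (upTo (suc n))

vertices : ℕ → List Point
vertices n = map (boundaryPoint n) (vertexAbscissae n)

vertexAbscissae-unique : ∀ n → Unique (vertexAbscissae n)
vertexAbscissae-unique n = Unique.filter⁺ (positiveStrictlyConvexAt? n) (Unique.upTo⁺ (suc n))

vertices-unique : ∀ n → Unique (vertices n)
vertices-unique n = Unique.map⁺ (cong proj₁) (vertexAbscissae-unique n)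

∈-vertexAbscissae⁻ : ∀ {n x} → x ∈ vertexAbscissae n → 1 ≤ x × x ≤ n × StrictlyConvexAt n x
∈-vertexAbscissae⁻ {n} x∈ =
  let x<1+n , 1≤x , convex = ∈.∈-filter⁻ (positiveStrictlyConvexAt? n) x∈ in 1≤x , ≤-pred (∈.∈-upTo⁻ x<1+n) , convex

∈-vertexAbscissae⁺ : ∀ {n x} → 1 ≤ x → x ≤ n → StrictlyConvexAt n x → x ∈ vertexAbscissae n
∈-vertexAbscissae⁺ {n} 1≤x x≤n convex = ∈.∈-filter⁺ (positiveStrictlyConvexAt? n) (∈.∈-upTo⁺ (s≤s x≤n)) (1≤x , convex)

module _ {n : ℕ} (n≥1 : 1 ≤ n) where

  InH⇒1≤x : ∀ {x y} → InH n (x , y) → 1 ≤ x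
  InH⇒1≤x {zero} n≤0 = contradiction (≤-trans n≥1 n≤0) λ ()
  InH⇒1≤x {suc x} _ = s≤s z≤n

  InH⇒1≤y : ∀ {x y} → InH n (x , y) → 1 ≤ y
  InH⇒1≤y {x} {zero} n≤x*0 = contradiction (≤-trans n≥1 (≤-trans n≤x*0 (≤-reflexive (*-zeroʳ x)))) λ ()
  InH⇒1≤y {y = suc y} _ = s≤s z≤n

  IsVertex⇒onBoundary : ∀ {x y} → IsVertex n (x , y) → 1 ≤ x × x ≤ n × y ≡ ⌈ n / x ⌉
  IsVertex⇒onBoundary {x} {y} v@(p∈H , _) = 1≤x , x≤n , y≡⌈n/x⌉
    where
    1≤x : 1 ≤ x
    1≤x = InH⇒1≤x p∈H
    x≤n : x ≤ n
    x≤n with ≤-<-connex x n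
    ... | inj₁ x≤n = x≤n
    ... | inj₂ (s≤s {n = x-1} n≤x-1) = contradiction v (belowChord⇒¬IsVertex {y1 = y} {y0 = y} {y2 = y}
      (n<1+n x-1) (n<1+n x) ≤-refl ≤-refl
      (≤-trans n≤x-1 (≤-trans (≤-reflexive (sym (*-identityʳ x-1))) (*-monoʳ-≤ x-1 (InH⇒1≤y {x} p∈H))))
      (≤-trans p∈H (*-monoˡ-≤ y (n≤1+n x))) p∈H
      (subst (λ d → d * (suc x ∸ x) ≤ d * (x ∸ x-1)) (sym (n∸n≡0 y)) z≤n))
    y≡⌈n/x⌉ : y ≡ ⌈ n / x ⌉
    y≡⌈n/x⌉ with m≤n⇒m<n∨m≡n (⌈n/x⌉-least 1≤x p∈H)
    ... | inj₂ ⌈n/x⌉≡y = sym ⌈n/x⌉≡y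
    ... | inj₁ (s≤s {n = y-1} ⌈n/x⌉≤y-1) = contradiction v (verticalMidpoint⇒¬IsVertex
      (≤-trans (n≤x*⌈n/x⌉ n 1≤x) (*-monoʳ-≤ x ⌈n/x⌉≤y-1)) (≤-trans p∈H (*-monoʳ-≤ x (n≤1+n y))))

  IsVertex⇒StrictlyConvexAt : ∀ {x0} → IsVertex n (boundaryPoint n x0) → StrictlyConvexAt n x0
  IsVertex⇒StrictlyConvexAt v {x1} x1<x0 1≤x1 {x2} _ x0<x2 = decidable-stable (_ <? _) λ ¬convex →
    belowChord⇒¬IsVertex x1<x0 x0<x2
        (⌈n/x⌉-antitone n 1≤x1 (<⇒≤ x1<x0)) (⌈n/x⌉-antitone n 1≤x0 (<⇒≤ x0<x2))
        (boundaryPoint∈H 1≤x1) (boundaryPoint∈H (≤-trans 1≤x0 (<⇒≤ x0<x2))) (boundaryPoint∈H 1≤x0)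
        (≮⇒≥ ¬convex) v
    where
    1≤x0 : 1 ≤ _
    1≤x0 = ≤-trans 1≤x1 (<⇒≤ x1<x0)

  boundaryMinimum⇒IsVertex : ∀ {x0} α β → 1 ≤ x0 → x0 ≤ n → 1 ≤ α → 1 ≤ β →
    (∀ {x} → 1 ≤ x → x ≤ n → x ≢ x0 → linear α β (boundaryPoint n x0) < linear α β (boundaryPoint n x)) →
    IsVertex n (boundaryPoint n x0)
  boundaryMinimum⇒IsVertex {x0} α β 1≤x0 x0≤n 1≤α 1≤β minimal =
    strictMinimum⇒IsVertex α β _ (boundaryPoint∈H 1≤x0) beats
    where
    atMostLast : linear α β (boundaryPoint n x0) ≤ linear α β (boundaryPoint n n)
    atMostLast with x0 ≟ n
    ... | yes refl = ≤-refl
    ... | no x0≢n = <⇒≤ (minimal n≥1 ≤-refl (x0≢n ∘ sym))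
    beats : ∀ q → InH n q → q ≢ boundaryPoint n x0 → linear α β (boundaryPoint n x0) < linear α β q
    beats (x , y) q∈H q≢p with InH⇒1≤x q∈H | x ≤? n | x ≟ x0
    ... | 1≤x | yes x≤n | no x≢x0 =
      <-≤-trans (minimal 1≤x x≤n x≢x0) (linear-mono-≤ α β ≤-refl (⌈n/x⌉-least 1≤x q∈H))
    ... | 1≤x | yes x≤n | yes refl = +-monoʳ-< (α * x) (*-monoʳ-< β {{>-nonZero 1≤β}} ⌈n/x⌉<y)
      where
      ⌈n/x⌉<y : ⌈ n / x ⌉ < y
      ⌈n/x⌉<y = ≤∧≢⇒< (⌈n/x⌉-least 1≤x q∈H) (q≢p ∘ cong (x ,_) ∘ sym)
    ... | 1≤x | no x≰n | _ = ≤-<-trans atMostLast (+-mono-<-≤ (*-monoʳ-< α {{>-nonZero 1≤α}} (≰⇒> x≰n))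
      (*-monoʳ-≤ β (subst (_≤ y) (sym (⌈n/n⌉≡1 n≥1)) (InH⇒1≤y {x} q∈H))))

  supportingSlope⇒IsVertex : ∀ {x0} α β → 1 ≤ x0 → x0 ≤ n → 1 ≤ α → 1 ≤ β →
    (∀ {x1} → 1 ≤ x1 → x1 < x0 → α * (x0 ∸ x1) < β * (⌈ n / x1 ⌉ ∸ ⌈ n / x0 ⌉)) →
    (∀ {x2} → x0 < x2 → x2 ≤ n → β * (⌈ n / x0 ⌉ ∸ ⌈ n / x2 ⌉) < α * (x2 ∸ x0)) →
    IsVertex n (boundaryPoint n x0)
  supportingSlope⇒IsVertex {x0} α β 1≤x0 x0≤n 1≤α 1≤β left right =
    boundaryMinimum⇒IsVertex α β 1≤x0 x0≤n 1≤α 1≤β beats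
    where
    beats : ∀ {x} → 1 ≤ x → x ≤ n → x ≢ x0 → linear α β (boundaryPoint n x0) < linear α β (boundaryPoint n x)
    beats {x} 1≤x x≤n x≢x0 with <-cmp x x0
    ... | tri< x<x0 _ _ = linear-<-upLeft α β (<⇒≤ x<x0) (⌈n/x⌉-antitone n 1≤x (<⇒≤ x<x0)) (left 1≤x x<x0)
    ... | tri≈ _ x≡x0 _ = contradiction x≡x0 x≢x0
    ... | tri> _ _ x0<x = linear-<-downRight α β (<⇒≤ x0<x) (⌈n/x⌉-antitone n 1≤x0 (<⇒≤ x0<x)) (right x0<x x≤n)

  separatedSlopes⇒IsVertex : ∀ {x0} A B C D → 1 ≤ x0 → x0 ≤ n → 1 ≤ B → 1 ≤ D → C * B < A * D →
    (∀ {x1} → 1 ≤ x1 → x1 < x0 → A * (x0 ∸ x1) ≤ (⌈ n / x1 ⌉ ∸ ⌈ n / x0 ⌉) * B) →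
    (∀ {x2} → x0 < x2 → x2 ≤ n → (⌈ n / x0 ⌉ ∸ ⌈ n / x2 ⌉) * D ≤ C * (x2 ∸ x0)) →
    IsVertex n (boundaryPoint n x0)
  separatedSlopes⇒IsVertex {x0} A B C D 1≤x0 x0≤n 1≤B 1≤D C/D<A/B left right =
    supportingSlope⇒IsVertex (A * D + C * B) (2 * B * D) 1≤x0 x0≤n
      (≤-trans (≤-trans (s≤s z≤n) C/D<A/B) (m≤m+n (A * D) (C * B)))
      (*-mono-≤ (*-mono-≤ (s≤s (z≤n {1})) 1≤B) 1≤D)
      (λ {x1} 1≤x1 x1<x0 → mean<fraction A B C D _ (x0 ∸ x1) (m<n⇒0<n∸m x1<x0) C/D<A/B (left 1≤x1 x1<x0))
      (λ {x2} x0<x2 x2≤n → mean>fraction A B C D _ (x2 ∸ x0) (m<n⇒0<n∸m x0<x2) C/D<A/B (right x0<x2 x2≤n))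

  flattestLeftChord : ∀ {x0} → 2 ≤ x0 → ∃ λ m → 1 ≤ m × m < x0 ×
    (∀ {x1} → 1 ≤ x1 → x1 < x0 → (⌈ n / m ⌉ ∸ ⌈ n / x0 ⌉) * (x0 ∸ x1) ≤ (⌈ n / x1 ⌉ ∸ ⌈ n / x0 ⌉) * (x0 ∸ m))
  flattestLeftChord {suc zero} (s≤s ())
  flattestLeftChord {x0@(suc (suc k))} _ =
    let m , 1≤m , m≤k+1 , least = minimiser {_≼_ = _≼_} (λ a b → _ ≤? _) ≤-refl (λ ¬a≼b → <⇒≤ (≰⇒> ¬a≼b))
                                    (λ {a} {b} {c} → ≼-trans {a} {b} {c}) (s≤s (z≤n {k}))
    in m , 1≤m , s≤s m≤k+1 , λ 1≤x1 x1<x0 → least 1≤x1 (≤-pred x1<x0)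
    where
    rise run : ℕ → ℕ
    rise a = ⌈ n / a ⌉ ∸ ⌈ n / x0 ⌉
    run a = x0 ∸ a
    _≼_ : ℕ → ℕ → Set
    a ≼ b = rise a * run b ≤ rise b * run a
    ≼-trans : ∀ {a b c} → 1 ≤ b → b ≤ suc k → a ≼ b → b ≼ c → a ≼ c
    ≼-trans {a} {b} {c} _ b≤k+1 =
      cross-≤-trans {rise a} {run a} {rise b} {run b} {rise c} {run c} (m<n⇒0<n∸m (s≤s b≤k+1))

  steepestRightChord : ∀ {x0} → x0 < n → ∃ λ m → x0 < m × m ≤ n ×
    (∀ {x2} → x0 < x2 → x2 ≤ n → (⌈ n / x0 ⌉ ∸ ⌈ n / x2 ⌉) * (m ∸ x0) ≤ (⌈ n / x0 ⌉ ∸ ⌈ n / m ⌉) * (x2 ∸ x0))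
  steepestRightChord {x0} x0<n = minimiser {_≼_ = _≼_} (λ a b → _ ≤? _) ≤-refl (λ ¬a≼b → <⇒≤ (≰⇒> ¬a≼b))
    (λ {a} {b} {c} → ≼-trans {a} {b} {c}) x0<n
    where
    drop run : ℕ → ℕ
    drop a = ⌈ n / x0 ⌉ ∸ ⌈ n / a ⌉
    run a = a ∸ x0
    _≼_ : ℕ → ℕ → Set
    a ≼ b = drop b * run a ≤ drop a * run b
    ≼-trans : ∀ {a b c} → x0 < b → b ≤ n → a ≼ b → b ≼ c → a ≼ c
    ≼-trans {a} {b} {c} x0<b _ a≼b b≼c =
      cross-≤-trans {drop c} {run c} {drop b} {run b} {drop a} {run a} (m<n⇒0<n∸m x0<b) b≼c a≼b

  private
    noLeft : ∀ {A : Set} {x0} → ¬ 2 ≤ x0 → ∀ {x1} → 1 ≤ x1 → x1 < x0 → A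
    noLeft x0≱2 1≤x1 x1<x0 = contradiction (≤-trans (s≤s 1≤x1) x1<x0) x0≱2
    noRight : ∀ {A : Set} {x0} → ¬ x0 < n → ∀ {x2} → x0 < x2 → x2 ≤ n → A
    noRight x0≮n x0<x2 x2≤n = contradiction (<-≤-trans x0<x2 x2≤n) x0≮n

  -- A side without abscissae gets a dummy bound: 0/1 on the right, (C + 1)/D on the left.
  strictlyConvex⇒IsVertex : ∀ {x0} → 1 ≤ x0 → x0 ≤ n → StrictlyConvexAt n x0 → IsVertex n (boundaryPoint n x0)
  strictlyConvex⇒IsVertex {x0} 1≤x0 x0≤n convex with 2 ≤? x0 | x0 <? n
  ... | yes 2≤x0 | yes x0<n =
    let m1 , 1≤m1 , m1<x0 , flattest = flattestLeftChord 2≤x0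
        m2 , x0<m2 , m2≤n , steepest = steepestRightChord x0<n
    in separatedSlopes⇒IsVertex (⌈ n / m1 ⌉ ∸ ⌈ n / x0 ⌉) (x0 ∸ m1) (⌈ n / x0 ⌉ ∸ ⌈ n / m2 ⌉) (m2 ∸ x0)
         1≤x0 x0≤n (m<n⇒0<n∸m m1<x0) (m<n⇒0<n∸m x0<m2) (convex m1<x0 1≤m1 (s≤s m2≤n) x0<m2) flattest steepest
  ... | yes 2≤x0 | no x0≮n =
    let m1 , 1≤m1 , m1<x0 , flattest = flattestLeftChord 2≤x0
        x0≡n = ≤-antisym x0≤n (≮⇒≥ x0≮n)
        drop-at-last : 1 ≤ ⌈ n / m1 ⌉ ∸ ⌈ n / x0 ⌉
        drop-at-last = m<n⇒0<n∸m (begin-strict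
          ⌈ n / x0 ⌉ ≡⟨ cong ⌈ n /_⌉ x0≡n ⟩
          ⌈ n / n ⌉  ≡⟨ ⌈n/n⌉≡1 n≥1 ⟩
          1          <⟨ 2≤⌈n/x⌉ 1≤m1 (subst (m1 <_) x0≡n m1<x0) ⟩
          ⌈ n / m1 ⌉ ∎)
    in separatedSlopes⇒IsVertex (⌈ n / m1 ⌉ ∸ ⌈ n / x0 ⌉) (x0 ∸ m1) 0 1 1≤x0 x0≤n (m<n⇒0<n∸m m1<x0) ≤-refl
         (subst (0 <_) (sym (*-identityʳ _)) drop-at-last) flattest (noRight x0≮n)
    where open ≤-Reasoning
  ... | no x0≱2 | yes x0<n =
    let m2 , x0<m2 , m2≤n , steepest = steepestRightChord x0<n
    in separatedSlopes⇒IsVertex (suc (⌈ n / x0 ⌉ ∸ ⌈ n / m2 ⌉)) (m2 ∸ x0) (⌈ n / x0 ⌉ ∸ ⌈ n / m2 ⌉) (m2 ∸ x0)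
         1≤x0 x0≤n (m<n⇒0<n∸m x0<m2) (m<n⇒0<n∸m x0<m2) (m<n+m _ (m<n⇒0<n∸m x0<m2)) (noLeft x0≱2) steepest
  ... | no x0≱2 | no x0≮n =
    separatedSlopes⇒IsVertex 1 1 0 1 1≤x0 x0≤n ≤-refl ≤-refl ≤-refl (noLeft x0≱2) (noRight x0≮n)

  ∈-vertices⇔IsVertex : ∀ p → p ∈ vertices n ⇔ IsVertex n p
  ∈-vertices⇔IsVertex p = mk⇔ to from
    where
    to : p ∈ vertices n → IsVertex n p
    to p∈ with ∈.∈-map⁻ (boundaryPoint n) p∈
    ... | x , x∈ , refl = let 1≤x , x≤n , convex = ∈-vertexAbscissae⁻ x∈ in strictlyConvex⇒IsVertex 1≤x x≤n convex
    from : IsVertex n p → p ∈ vertices n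
    from v with IsVertex⇒onBoundary v
    ... | 1≤x , x≤n , refl = ∈.∈-map⁺ (boundaryPoint n) (∈-vertexAbscissae⁺ 1≤x x≤n (IsVertex⇒StrictlyConvexAt v))


  -- Lower bound

  smallColumn⇒IsVertex : ∀ {x0} → 1 ≤ x0 → x0 ^ 3 < n → IsVertex n (boundaryPoint n x0)
  smallColumn⇒IsVertex {x0} 1≤x0 x0^3<n =
    boundaryMinimum⇒IsVertex α β 1≤x0 x0≤n (≤-trans n≥1 (m≤m+n n β)) 1≤β beats
    where
    α β : ℕ
    α = supportingα n x0
    β = supportingβ x0
    1≤β : 1 ≤ β
    1≤β = *-mono-≤ 1≤x0 (s≤s (z≤n {x0}))
    x0≤n : x0 ≤ n
    x0≤n = ≤-trans (n≤n^3 x0) (<⇒≤ x0^3<n)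
    beats : ∀ {x} → 1 ≤ x → x ≤ n → x ≢ x0 → linear α β (boundaryPoint n x0) < linear α β (boundaryPoint n x)
    beats {x} 1≤x _ x≢x0 = *-cancelˡ-< (x * x0) _ _ (begin-strict
      x * x0 * (α * x0 + β * ⌈ n / x0 ⌉)            ≡⟨ expand x x0 α β ⌈ n / x0 ⌉ ⟩
      α * x * x0 * x0 + β * x * (x0 * ⌈ n / x0 ⌉)   <⟨ +-monoʳ-< (α * x * x0 * x0)
                                                        (*-monoʳ-< (β * x) {{>-nonZero (*-mono-≤ 1≤β 1≤x)}}
                                                          (x*⌈n/x⌉<n+x n 1≤x0)) ⟩
      α * x * x0 * x0 + β * x * (n + x0)            ≤⟨ supporting-cleared n x≢x0 x0^3<n ⟩
      α * x * x * x0 + β * x0 * n                   ≤⟨ +-monoʳ-≤ (α * x * x * x0) (*-monoʳ-≤ (β * x0) (n≤x*⌈n/x⌉ n 1≤x)) ⟩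
      α * x * x * x0 + β * x0 * (x * ⌈ n / x ⌉)     ≡⟨ collect x x0 α β ⌈ n / x ⌉ ⟩
      x * x0 * (α * x + β * ⌈ n / x ⌉)              ∎)
      where
      open ≤-Reasoning
      expand : ∀ x x0 α β y → x * x0 * (α * x0 + β * y) ≡ α * x * x0 * x0 + β * x * (x0 * y)
      expand = solve-∀
      collect : ∀ x x0 α β y → α * x * x * x0 + β * x0 * (x * y) ≡ x * x0 * (α * x + β * y)
      collect = solve-∀

  smallColumn⇒x<⌈n/x⌉ : ∀ {x} → 1 ≤ x → x ^ 3 < n → x < ⌈ n / x ⌉
  smallColumn⇒x<⌈n/x⌉ {x} 1≤x x^3<n = ≤-<-trans (m≤m*n x x {{>-nonZero 1≤x}})
    (*-cancelˡ-< x (x * x) ⌈ n / x ⌉ (<-≤-trans (subst (_< n) (cong (x *_) (cong (x *_) (*-identityʳ x))) x^3<n)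
                                                (n≤x*⌈n/x⌉ n 1≤x)))

  private
    #small : ℕ
    #small = ⌈∛ n ⌉ ∸ 1

    small : ∀ {i} → i ∈ upTo #small → suc i ^ 3 < n
    small {i} i∈ = x<⌈∛n⌉⇒x^3<n (subst (suc i <_) (m+[n∸m]≡n (1≤⌈∛n⌉ n≥1)) (s≤s (∈.∈-upTo⁻ i∈)))

    column row : ℕ → Point
    column i = boundaryPoint n (suc i)
    row i = swap (column i)

  smallColumnVertices : List Point
  smallColumnVertices = map column (upTo #small) ++ map row (upTo #small)

  smallColumnVertices-unique : Unique smallColumnVertices
  smallColumnVertices-unique = Unique.++⁺ (Unique.map⁺ (suc-injective ∘ cong proj₁) (Unique.upTo⁺ #small))
                                          (Unique.map⁺ (suc-injective ∘ cong proj₂) (Unique.upTo⁺ #small)) disjoint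
    where
    disjoint : ∀ {v} → ¬ (v ∈ map column (upTo #small) × v ∈ map row (upTo #small))
    disjoint (v∈columns , v∈rows) with ∈.∈-map⁻ column v∈columns | ∈.∈-map⁻ row v∈rows
    ... | i , i∈ , refl | j , j∈ , v≡ = <-asym
      (subst (suc i <_) (cong proj₂ v≡) (smallColumn⇒x<⌈n/x⌉ (s≤s z≤n) (small i∈)))
      (subst (suc j <_) (sym (cong proj₁ v≡)) (smallColumn⇒x<⌈n/x⌉ (s≤s z≤n) (small j∈)))

  smallColumnVertices⊆vertices : smallColumnVertices ⊆ vertices n
  smallColumnVertices⊆vertices v∈ with ∈.∈-++⁻ (map column (upTo #small)) v∈
  ... | inj₁ v∈columns with ∈.∈-map⁻ column v∈columns
  ...   | i , i∈ , refl = Equivalence.from (∈-vertices⇔IsVertex _) (smallColumn⇒IsVertex (s≤s z≤n) (small i∈))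
  smallColumnVertices⊆vertices v∈ | inj₂ v∈rows with ∈.∈-map⁻ row v∈rows
  ...   | i , i∈ , refl =
    Equivalence.from (∈-vertices⇔IsVertex _) (IsVertex-swap (smallColumn⇒IsVertex (s≤s z≤n) (small i∈)))

  length-smallColumnVertices : length smallColumnVertices ≡ #small + #small
  length-smallColumnVertices = begin
    length (map column (upTo #small) ++ map row (upTo #small))
      ≡⟨ List.length-++ (map column (upTo #small)) ⟩
    length (map column (upTo #small)) + length (map row (upTo #small))
      ≡⟨ cong₂ _+_ (List.length-map column (upTo #small)) (List.length-map row (upTo #small)) ⟩
    length (upTo #small) + length (upTo #small)
      ≡⟨ cong₂ _+_ (List.length-upTo #small) (List.length-upTo #small) ⟩
    #small + #small ∎
    where open ≡-Reasoning

  8n≤[#vertices+2]^3 : 8 * n ≤ (length (vertices n) + 2) ^ 3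
  8n≤[#vertices+2]^3 = begin
    8 * n                          ≤⟨ *-monoʳ-≤ 8 (n≤⌈∛n⌉^3 n) ⟩
    8 * ⌈∛ n ⌉ ^ 3                 ≡⟨ cong (λ c → 8 * c ^ 3) (sym (m+[n∸m]≡n (1≤⌈∛n⌉ n≥1))) ⟩
    8 * suc #small ^ 3             ≡⟨ cube-double #small ⟩
    (#small + #small + 2) ^ 3      ≤⟨ ^-monoˡ-≤ 3 (+-monoˡ-≤ 2 (subst (_≤ length (vertices n)) length-smallColumnVertices
                                        (Unique-⊆⇒length-≤ smallColumnVertices-unique smallColumnVertices⊆vertices))) ⟩
    (length (vertices n) + 2) ^ 3  ∎
    where
    open ≤-Reasoning
    cube-double : ∀ k → 8 * (suc k * (suc k * (suc k * 1))) ≡ (k + k + 2) * ((k + k + 2) * ((k + k + 2) * 1))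
    cube-double = solve-∀

  -- Upper bound

  ⌈n/x⌉-drops-at-convex : ∀ {x x'} → 1 ≤ x → x < x' → x' ≤ n → StrictlyConvexAt n x' → ⌈ n / x' ⌉ < ⌈ n / x ⌉
  ⌈n/x⌉-drops-at-convex {x} {x'} 1≤x x<x' x'≤n convex = ≤∧≢⇒< (⌈n/x⌉-antitone n 1≤x (<⇒≤ x<x')) λ level →
    belowChord⇒¬IsVertex x<x' (n<1+n x') (⌈n/x⌉-antitone n 1≤x (<⇒≤ x<x')) (≤-reflexive (sym level))
      (boundaryPoint∈H 1≤x) (≤-trans (boundaryPoint∈H 1≤x) (*-monoˡ-≤ ⌈ n / x ⌉ (≤-trans (<⇒≤ x<x') (n≤1+n x'))))
      (boundaryPoint∈H 1≤x')
      (subst (λ d → d * (suc x' ∸ x') ≤ (⌈ n / x' ⌉ ∸ ⌈ n / x ⌉) * (x' ∸ x))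
             (sym (trans (cong (⌈ n / x ⌉ ∸_) level) (n∸n≡0 ⌈ n / x ⌉))) z≤n)
      (strictlyConvex⇒IsVertex 1≤x' x'≤n convex)
    where
    1≤x' : 1 ≤ x'
    1≤x' = ≤-trans 1≤x (<⇒≤ x<x')

  lastStrictlyConvex : StrictlyConvexAt n n
  lastStrictlyConvex _ _ x2<1+n n<x2 = contradiction (≤-pred x2<1+n) (<⇒≱ n<x2)

  private
    nextVertexData : ∀ {x} → x < n →
      ∃ λ m → m ≤ n × (x < m × StrictlyConvexAt n m) × (∀ {j} → j < m → ¬ (x < j × StrictlyConvexAt n j))
    nextVertexData {x} x<n = leastWitness (λ z → (x <? z) ×-dec strictlyConvexAt? n z) n (x<n , lastStrictlyConvex)

  next : ∀ {x} → x < n → ℕ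
  next x<n = proj₁ (nextVertexData x<n)

  x<next : ∀ {x} (x<n : x < n) → x < next x<n
  x<next x<n = proj₁ (proj₁ (proj₂ (proj₂ (nextVertexData x<n))))

  next≤n : ∀ {x} (x<n : x < n) → next x<n ≤ n
  next≤n x<n = proj₁ (proj₂ (nextVertexData x<n))

  next-convex : ∀ {x} (x<n : x < n) → StrictlyConvexAt n (next x<n)
  next-convex x<n = proj₂ (proj₁ (proj₂ (proj₂ (nextVertexData x<n))))

  next-least : ∀ {x z} (x<n : x < n) → x < z → StrictlyConvexAt n z → next x<n ≤ z
  next-least x<n x<z convex = ≮⇒≥ λ z<next → proj₂ (proj₂ (proj₂ (nextVertexData x<n))) z<next (x<z , convex)

  private
    c : ℕ
    c = ⌈∛ n ⌉

    instance
      c≢0 : NonZero c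
      c≢0 = >-nonZero (1≤⌈∛n⌉ n≥1)

  -- scale x is the 2^k of the dyadic block of x; widthUnit and heightUnit are the s and t of the argument.
  scale : ℕ → ℕ
  scale x = 2 ^ lg x

  widthUnit heightUnit : ℕ → ℕ
  widthUnit x = scale x / c
  heightUnit x = ⌈ n / scale x ⌉ / c

  width height : ∀ {x} → x < n → ℕ
  width {x} x<n = next x<n ∸ x
  height {x} x<n = ⌈ n / x ⌉ ∸ ⌈ n / next x<n ⌉

  data Shape (x : ℕ) : ℕ → Set where
    last  : n ≤ x → Shape x 0
    short : (x<n : x < n) → width x<n ≤ widthUnit x → height x<n ≤ heightUnit x → Shape x 1
    wide  : (x<n : x < n) → widthUnit x < width x<n → Shape x 2
    tall  : (x<n : x < n) → width x<n ≤ widthUnit x → heightUnit x < height x<n → Shape x 3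

  shape : ∀ x → Σ ℕ (Shape x)
  shape x with x <? n
  ... | no x≮n = 0 , last (≮⇒≥ x≮n)
  ... | yes x<n with width x<n ≤? widthUnit x | height x<n ≤? heightUnit x
  ...   | yes w≤s | yes h≤t = 1 , short x<n w≤s h≤t
  ...   | no w≰s  | _       = 2 , wide x<n (≰⇒> w≰s)
  ...   | yes w≤s | no h≰t  = 3 , tall x<n w≤s (≰⇒> h≰t)

  offset : ∀ {x k} → Shape x k → ℕ
  offset (last _) = 0
  offset {x} (short x<n _ _) = (width x<n ∸ 1) * heightUnit x + (height x<n ∸ 1)
  offset {x} (wide _ _) = (x ∸ scale x) / suc (widthUnit x)
  offset {x} (tall _ _ _) = ⌈ n / x ⌉ / suc (heightUnit x)

  digits : ∀ x → Σ ℕ (Shape x) → ℕ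
  digits x (k , σ) = (lg x * 4 + k) * (2 * c) + offset σ

  code : ℕ → ℕ
  code x = digits x (shape x)

  1≤width : ∀ {x} (x<n : x < n) → 1 ≤ width x<n
  1≤width x<n = m<n⇒0<n∸m (x<next x<n)

  1≤height : ∀ {x} → 1 ≤ x → (x<n : x < n) → 1 ≤ height x<n
  1≤height 1≤x x<n = m<n⇒0<n∸m (⌈n/x⌉-drops-at-convex 1≤x (x<next x<n) (next≤n x<n) (next-convex x<n))

  1≤scale : ∀ x → 1 ≤ scale x
  1≤scale x = m^n>0 2 (lg x)

  lg≤⌊log₂n⌋ : ∀ {x} → 1 ≤ x → x ≤ n → lg x ≤ ⌊log₂ n ⌋
  lg≤⌊log₂n⌋ {x} 1≤x x≤n = subst (_≤ ⌊log₂ n ⌋) (⌊log₂[2^n]⌋≡n (lg x)) (⌊log₂⌋-mono-≤ (≤-trans (2^lg≤x 1≤x) x≤n))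

  widthUnit*heightUnit<2c : ∀ {x} → 1 ≤ x → x ≤ n → widthUnit x * heightUnit x < 2 * c
  widthUnit*heightUnit<2c {x} 1≤x x≤n = *-cancelʳ-< (c * c) (s * t) (2 * c) (begin-strict
    s * t * (c * c)           ≡⟨ interchange s t c ⟩
    (s * c) * (t * c)         ≤⟨ *-mono-≤ (m/n*n≤m X c) (m/n*n≤m ⌈ n / X ⌉ c) ⟩
    X * ⌈ n / X ⌉             <⟨ x*⌈n/x⌉<n+x n (1≤scale x) ⟩
    n + X                     ≤⟨ +-mono-≤ (n≤⌈∛n⌉^3 n) (≤-trans (≤-trans (2^lg≤x 1≤x) x≤n) (n≤⌈∛n⌉^3 n)) ⟩
    c ^ 3 + c ^ 3             ≡⟨ double-cube c ⟩
    2 * c * (c * c)           ∎)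
    where
    open ≤-Reasoning
    X s t : ℕ
    X = scale x
    s = widthUnit x
    t = heightUnit x
    interchange : ∀ s t c → s * t * (c * c) ≡ (s * c) * (t * c)
    interchange = solve-∀
    double-cube : ∀ c → c * (c * (c * 1)) + c * (c * (c * 1)) ≡ 2 * c * (c * c)
    double-cube = solve-∀

  shape<4 : ∀ {x k} → Shape x k → k < 4
  shape<4 (last _) = s≤s z≤n
  shape<4 (short _ _ _) = s≤s (s≤s z≤n)
  shape<4 (wide _ _) = s≤s (s≤s (s≤s z≤n))
  shape<4 (tall _ _ _) = s≤s (s≤s (s≤s (s≤s z≤n)))

  offset<2c : ∀ {x k} → 1 ≤ x → x ≤ n → (σ : Shape x k) → offset σ < 2 * c
  offset<2c _ _ (last _) = ≤-trans (1≤⌈∛n⌉ n≥1) (m≤n*m c 2)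
  offset<2c {x} 1≤x x≤n (short x<n w≤s h≤t) = begin-strict
    (width x<n ∸ 1) * t + (height x<n ∸ 1) <⟨ +-monoʳ-< _ (<-≤-trans (m∸1<m (1≤height 1≤x x<n)) h≤t) ⟩
    (width x<n ∸ 1) * t + t                ≡⟨ [m∸1]*n+n≡m*n (1≤width x<n) ⟩
    width x<n * t                          ≤⟨ *-monoˡ-≤ t w≤s ⟩
    widthUnit x * t                        <⟨ widthUnit*heightUnit<2c 1≤x x≤n ⟩
    2 * c                                  ∎
    where
    open ≤-Reasoning
    t : ℕ
    t = heightUnit x
  offset<2c {x} 1≤x x≤n (wide _ _) = <-≤-trans (m<n*o⇒m/o<n (begin-strict
    x ∸ X                    <⟨ +-cancelˡ-< X (x ∸ X) X (subst (_< X + X) (sym (m+[n∸m]≡n (2^lg≤x 1≤x)))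
                                  (subst (x <_) (cong (X +_) (+-identityʳ X)) (x<2^[1+lg] x))) ⟩
    X                        <⟨ m<n*[1+m/n] X c ⟩
    c * suc (widthUnit x)    ∎)) (m≤n*m c 2)
    where
    open ≤-Reasoning
    X : ℕ
    X = scale x
  offset<2c {x} 1≤x x≤n (tall _ _ _) = <-≤-trans (m<n*o⇒m/o<n (begin-strict
    ⌈ n / x ⌉                 ≤⟨ ⌈n/x⌉-antitone n (1≤scale x) (2^lg≤x 1≤x) ⟩
    ⌈ n / scale x ⌉           <⟨ m<n*[1+m/n] ⌈ n / scale x ⌉ c ⟩
    c * suc (heightUnit x)    ∎)) (m≤n*m c 2)
    where open ≤-Reasoning

  sameBlock⇒offset≢ : ∀ {x x' k} → x ∈ vertexAbscissae n → x' ∈ vertexAbscissae n → x < x' → lg x ≡ lg x' →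
    (σ : Shape x k) (σ' : Shape x' k) → offset σ ≢ offset σ'
  sameBlock⇒offset≢ {x} {x'} x∈ x'∈ x<x' lg≡ = differ
    where
    1≤x : 1 ≤ x
    1≤x = proj₁ (∈-vertexAbscissae⁻ {n} x∈)
    1≤x' : 1 ≤ x'
    1≤x' = proj₁ (∈-vertexAbscissae⁻ {n} x'∈)
    x'≤n : x' ≤ n
    x'≤n = proj₁ (proj₂ (∈-vertexAbscissae⁻ {n} x'∈))
    x'-convex : StrictlyConvexAt n x'
    x'-convex = proj₂ (proj₂ (∈-vertexAbscissae⁻ {n} x'∈))
    scale≡ : scale x' ≡ scale x
    scale≡ = cong (2 ^_) (sym lg≡)
    next≤x' : ∀ (x<n : x < n) → next x<n ≤ x'
    next≤x' x<n = next-least x<n x<x' x'-convex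
    differ : ∀ {k} (σ : Shape x k) (σ' : Shape x' k) → offset σ ≢ offset σ'
    differ (last n≤x) (last _) _ = <⇒≱ (<-≤-trans x<x' x'≤n) n≤x
    differ (short x<n _ h≤t) (short x'<n _ h'≤t') offsets≡ =
      equalEdges⇒¬IsVertex (x<next x<n) (next≤x' x<n) (x<next x'<n)
        (⌈n/x⌉-antitone n 1≤x' (<⇒≤ (x<next x'<n))) (⌈n/x⌉-antitone n 1≤next (next≤x' x<n))
        (⌈n/x⌉-antitone n 1≤x (<⇒≤ (x<next x<n)))
        (∸-cancelʳ-≡ (1≤width x<n) (1≤width x'<n) (proj₁ edges≡))
        (∸-cancelʳ-≡ (1≤height 1≤x x<n) (1≤height 1≤x' x'<n) (proj₂ edges≡))
        (boundaryPoint∈H 1≤x) (boundaryPoint∈H (≤-trans 1≤x' (<⇒≤ (x<next x'<n))))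
        (strictlyConvex⇒IsVertex 1≤next (next≤n x<n) (next-convex x<n)) (strictlyConvex⇒IsVertex 1≤x' x'≤n x'-convex)
      where
      1≤next : 1 ≤ next x<n
      1≤next = ≤-trans 1≤x (<⇒≤ (x<next x<n))
      t≡ : heightUnit x' ≡ heightUnit x
      t≡ = cong (λ X → ⌈ n / X ⌉ / c) scale≡
      edges≡ : width x<n ∸ 1 ≡ width x'<n ∸ 1 × height x<n ∸ 1 ≡ height x'<n ∸ 1
      edges≡ = mixedRadix-injective (width x<n ∸ 1) (width x'<n ∸ 1)
        (<-≤-trans (m∸1<m (1≤height 1≤x x<n)) h≤t)
        (<-≤-trans (m∸1<m (1≤height 1≤x' x'<n)) (subst (height x'<n ≤_) t≡ h'≤t'))
        (trans offsets≡ (cong (λ t → (width x'<n ∸ 1) * t + (height x'<n ∸ 1)) t≡))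
    differ (wide x<n s<w) (wide _ _) offsets≡ =
      <⇒≢ increases (trans offsets≡ (cong (λ X → (x' ∸ X) / suc (X / c)) scale≡))
      where
      open ≤-Reasoning
      increases : (x ∸ scale x) / suc (widthUnit x) < (x' ∸ scale x) / suc (widthUnit x)
      increases = m+o≤n⇒m/o<n/o _ _ _ (begin
        (x ∸ scale x) + suc (widthUnit x)  ≡⟨ +-∸-comm (suc (widthUnit x)) (2^lg≤x 1≤x) ⟨
        (x + suc (widthUnit x)) ∸ scale x  ≤⟨ ∸-monoˡ-≤ (scale x) (begin
          x + suc (widthUnit x)              ≤⟨ +-monoʳ-≤ x s<w ⟩
          x + width x<n                      ≡⟨ m+[n∸m]≡n (<⇒≤ (x<next x<n)) ⟩
          next x<n                           ≤⟨ next≤x' x<n ⟩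
          x'                                 ∎) ⟩
        x' ∸ scale x                       ∎)
    differ (tall x<n _ t<h) (tall _ _ _) offsets≡ =
      <⇒≢ decreases (sym (trans offsets≡ (cong (λ X → ⌈ n / x' ⌉ / suc (⌈ n / X ⌉ / c)) scale≡)))
      where
      open ≤-Reasoning
      decreases : ⌈ n / x' ⌉ / suc (heightUnit x) < ⌈ n / x ⌉ / suc (heightUnit x)
      decreases = m+o≤n⇒m/o<n/o _ _ _ (begin
        ⌈ n / x' ⌉ + suc (heightUnit x)    ≤⟨ +-mono-≤ (⌈n/x⌉-antitone n 1≤next (next≤x' x<n)) t<h ⟩
        ⌈ n / next x<n ⌉ + height x<n      ≡⟨ m+[n∸m]≡n (⌈n/x⌉-antitone n 1≤x (<⇒≤ (x<next x<n))) ⟩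
        ⌈ n / x ⌉                          ∎)
        where
        1≤next : 1 ≤ next x<n
        1≤next = ≤-trans 1≤x (<⇒≤ (x<next x<n))

  private
    member-bounds : ∀ {x} → x ∈ vertexAbscissae n → 1 ≤ x × x ≤ n
    member-bounds x∈ = let 1≤x , x≤n , _ = ∈-vertexAbscissae⁻ {n} x∈ in 1≤x , x≤n

  code<N : ∀ {x} → x ∈ vertexAbscissae n → code x < suc ⌊log₂ n ⌋ * 4 * (2 * c)
  code<N {x} x∈ with member-bounds x∈ | shape x
  ... | 1≤x , x≤n | k , σ = mixedRadix-< (mixedRadix-< (s≤s (lg≤⌊log₂n⌋ 1≤x x≤n)) (shape<4 σ)) (offset<2c 1≤x x≤n σ)

  code-injective : ∀ {x x'} → x ∈ vertexAbscissae n → x' ∈ vertexAbscissae n → code x ≡ code x' → x ≡ x'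
  code-injective {x} {x'} x∈ x'∈ = digits-injective (shape x) (shape x')
    where
    digits-injective : (kσ : Σ ℕ (Shape x)) (kσ' : Σ ℕ (Shape x')) → digits x kσ ≡ digits x' kσ' → x ≡ x'
    digits-injective (k , σ) (k' , σ') digits≡
      with mixedRadix-injective (lg x * 4 + k) (lg x' * 4 + k')
             (offset<2c (proj₁ (member-bounds x∈)) (proj₂ (member-bounds x∈)) σ)
             (offset<2c (proj₁ (member-bounds x'∈)) (proj₂ (member-bounds x'∈)) σ') digits≡
    ... | high≡ , offsets≡ with mixedRadix-injective (lg x) (lg x') (shape<4 σ) (shape<4 σ') high≡
    ...   | lg≡ , refl with <-cmp x x'
    ...     | tri< x<x' _ _ = contradiction offsets≡ (sameBlock⇒offset≢ x∈ x'∈ x<x' lg≡ σ σ')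
    ...     | tri≈ _ x≡x' _ = x≡x'
    ...     | tri> _ _ x'<x = contradiction (sym offsets≡) (sameBlock⇒offset≢ x'∈ x∈ x'<x (sym lg≡) σ' σ)

  #vertices^3≤ : length (vertices n) ^ 3 ≤ 4096 * n * (⌊log₂ n ⌋ + 2) ^ 3
  #vertices^3≤ = begin
    length (vertices n) ^ 3          ≡⟨ cong (_^ 3) (List.length-map (boundaryPoint n) (vertexAbscissae n)) ⟩
    length (vertexAbscissae n) ^ 3   ≤⟨ ^-monoˡ-≤ 3 (injectionBelow⇒length-≤ code _ (vertexAbscissae-unique n) code<N code-injective) ⟩
    (suc L * 4 * (2 * c)) ^ 3        ≡⟨ expand L c ⟩
    512 * c ^ 3 * suc L ^ 3          ≤⟨ *-mono-≤ (*-monoʳ-≤ 512 (⌈∛n⌉^3≤8*n n≥1)) (^-monoˡ-≤ 3 1+L≤L+2) ⟩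
    512 * (8 * n) * (L + 2) ^ 3      ≡⟨ cong (_* (L + 2) ^ 3) (*-assoc 512 8 n) ⟨
    4096 * n * (L + 2) ^ 3           ∎
    where
    open ≤-Reasoning
    L : ℕ
    L = ⌊log₂ n ⌋
    1+L≤L+2 : suc L ≤ L + 2
    1+L≤L+2 = ≤-trans (n≤1+n (suc L)) (≤-reflexive (+-comm 2 L))
    expand : ∀ L c → let N = suc L * 4 * (2 * c) in
      N * (N * (N * 1)) ≡ 512 * (c * (c * (c * 1))) * (suc L * (suc L * (suc L * 1)))
    expand = solve-∀

corollary1p2 : Σ ℕ λ C →
    (n : ℕ) → 1 ≤ n →
    Σ (List Point) λ V →
    Unique V
    × ((p : Point) → (p ∈ V) ⇔ IsVertex n p)
    × 8 * n ≤ (length V + 2) ^ 3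
    × (length V) ^ 3 ≤ C * n * (⌊log₂ n ⌋ + 2) ^ 3
corollary1p2 = 4096 , λ n n≥1 →
  vertices n , vertices-unique n , ∈-vertices⇔IsVertex n≥1 , 8n≤[#vertices+2]^3 n≥1 , #vertices^3≤ n≥1
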